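{- Let $\Lambda$ be an optimal hyperplane cover of a $d$-dimensional extremal $(0,1)$-matrix $A$ of order $n$ with deficiency $\delta$. Then every entry $\lambda_{i,j}$ of $\Lambda$ with $\lambda_{i,j}\notin\{0,1\}$ satisfies $\delta\le\lambda_{i,j}\le 1-\delta$.
   Context: A $d$-dimensional matrix of order $n$ is an array $(a_\alpha)_{\alpha\in\{1,\dots,n\}^d}$; $\mathrm{supp}(A)=\{\alpha:a_\alpha\ne0\}$; the hyperplane $\Gamma_{i,j}$ is the set of indices with $\alpha_i=j$. A polyplex of weight $W$ is a nonnegative matrix $K$ of order $n$ whose entries sum to at most $1$ over each hyperplane and to $W$ in total; a polydiagonal is a polyplex of weight $n$. A $(0,1)$-matrix $A$ contains $K$ if $\mathrm{supp}(K)\subseteq\mathrm{supp}(A)$. A hyperplane cover of $A$ is a nonnegative $d\times n$ table $\Lambda=(\lambda_{i,j})$ with $\sum_{i=1}^d\lambda_{i,\alpha_i}\ge1$ for all $\alpha\in\mathrm{supp}(A)$; its weight is the sum of its entries; it is optimal if it has minimum weight among hyperplane covers of $A$. A $(0,1)$-matrix $A$ is extremal if it contains no polydiagonal, but for every index $\alpha$ with $a_\alpha=0$ the matrix obtained by changing $a_\alpha$ to $1$ contains a polydiagonal. The deficiency of an extremal matrix of order $n$ is $n$ minus the maximum weight of a polyplex contained in it.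
   Formalization: Hyperplane covers, both Λ and those it is compared with for optimality, and the polyplexes and polydiagonals entering extremality and deficiency have rational entries. -}

module Defs where

open import Data.Nat using (ℕ; zero; suc)
open import Data.Integer using (+_)
open import Data.Fin using (Fin)
import Data.Fin as Fin
open import Data.Fin.Properties using () renaming (_≟_ to _≟F_)
open import Data.Vec using (Vec; []; _∷_; lookup)
open import Data.Vec.Properties using (≡-dec)
open import Data.List using (List; []; _∷_; map; concatMap; filter; foldr; allFin)
open import Data.Rational using (ℚ; 0ℚ; 1ℚ; _+_; _-_; _≤_; _/_)
open import Data.Bool using (Bool; true; false; if_then_else_)
open import Data.Product using (Σ; _×_; ∃)
open import Relation.Nullary using (¬_; does)
open import Relation.Binary.PropositionalEquality using (_≡_; _≢_)

Index : ℕ → ℕ → Set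
Index d n = Vec (Fin n) d

allIdx : (d n : ℕ) → List (Index d n)
allIdx zero n = [] ∷ []
allIdx (suc d) n = concatMap (λ i → map (i ∷_) (allIdx d n)) (allFin n)

Matrix01 : ℕ → ℕ → Set
Matrix01 d n = Index d n → Bool

QMatrix : ℕ → ℕ → Set
QMatrix d n = Index d n → ℚ

sumℚ : List ℚ → ℚ
sumℚ = foldr _+_ 0ℚ

ℕtoℚ : ℕ → ℚ
ℕtoℚ m = (+ m) / 1

total : ∀ {d n} → QMatrix d n → ℚ
total {d} {n} K = sumℚ (map K (allIdx d n))

-- sum of entries over the hyperplane Γ_{i,j} = {α : α_i = j}
hyperSum : ∀ {d n} → QMatrix d n → Fin d → Fin n → ℚ
hyperSum {d} {n} K i j =
  sumℚ (map K (filter (λ α → lookup α i ≟F j) (allIdx d n)))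

IsPolyplex : ∀ {d n} → QMatrix d n → ℚ → Set
IsPolyplex {d} {n} K W =
  (∀ α → 0ℚ ≤ K α) × (∀ i j → hyperSum K i j ≤ 1ℚ) × (total K ≡ W)

IsPolydiagonal : ∀ {d n} → QMatrix d n → Set
IsPolydiagonal {d} {n} K = IsPolyplex K (ℕtoℚ n)

Contains : ∀ {d n} → Matrix01 d n → QMatrix d n → Set
Contains A K = ∀ α → K α ≢ 0ℚ → A α ≡ true

ContainsPolydiagonal : ∀ {d n} → Matrix01 d n → Set
ContainsPolydiagonal {d} {n} A = ∃ λ (K : QMatrix d n) → IsPolydiagonal K × Contains A K

setOne : ∀ {d n} → Matrix01 d n → Index d n → Matrix01 d n
setOne A α β = if does (≡-dec _≟F_ β α) then true else A β

IsExtremal : ∀ {d n} → Matrix01 d n → Set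
IsExtremal A =
  (¬ ContainsPolydiagonal A) ×
  (∀ α → A α ≡ false → ContainsPolydiagonal (setOne A α))

IsDeficiency : ∀ {d n} → Matrix01 d n → ℚ → Set
IsDeficiency {d} {n} A δ =
  (∃ λ (K : QMatrix d n) → IsPolyplex K (ℕtoℚ n - δ) × Contains A K) ×
  (∀ (K : QMatrix d n) W → IsPolyplex K W → Contains A K → W ≤ ℕtoℚ n - δ)

Table : ℕ → ℕ → Set
Table d n = Fin d → Fin n → ℚ

coverSum : ∀ {d n} → Table d n → Index d n → ℚ
coverSum {d} Λ α = sumℚ (map (λ i → Λ i (lookup α i)) (allFin d))

weight : ∀ {d n} → Table d n → ℚ
weight {d} {n} Λ = sumℚ (map (λ i → sumℚ (map (Λ i) (allFin n))) (allFin d))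

IsHyperplaneCover : ∀ {d n} → Matrix01 d n → Table d n → Set
IsHyperplaneCover A Λ =
  (∀ i j → 0ℚ ≤ Λ i j) × (∀ α → A α ≡ true → 1ℚ ≤ coverSum Λ α)

IsOptimalCover : ∀ {d n} → Matrix01 d n → Table d n → Set
IsOptimalCover {d} {n} A Λ =
  IsHyperplaneCover A Λ × (∀ (Λ' : Table d n) → IsHyperplaneCover A Λ' → weight Λ ≤ weight Λ')

-- Linear programming duality, obtained from Farkas' lemma proved by Fourier–Motzkin elimination, shows
-- that the optimal cover Λ has weight at most n − δ, the largest weight of a polyplex K contained in A.
-- Complementary slackness between Λ and K gives a zero entry in every row of Λ, because the hyperplane
-- sums of K in any one direction add up to n − δ < n. Comparing Λ with a polydiagonal of A with a zero α
-- switched on, which puts weight at most 1 on α, gives coverSum Λ α ≤ 1 − δ for every zero α of A.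
-- Now let 0 < λ = Λ i j < 1. If moving coordinate i of some zero α of A to j gives a one of A, then
-- λ ≥ 1 − coverSum Λ α ≥ δ; otherwise Λ i j could be lowered to 0, using a zero entry of row i, against
-- optimality. If Γ_{i,j} contains a zero α of A, then λ ≤ coverSum Λ α ≤ 1 − δ; otherwise the index of
-- Γ_{i,j} meeting a zero entry of Λ in every other direction would be covered by λ < 1 alone.

module Submission where

open import Defs
open import Data.Nat using (ℕ; zero; suc)
import Data.Nat as ℕ
import Data.Integer as ℤ
import Data.Integer.Properties as ℤ
import Data.Nat.Coprimality as Coprimality
open import Data.Fin using (Fin; zero; suc; combine; _↑ˡ_; _↑ʳ_; quotient; remainder)
open import Data.Fin.Properties using (remQuot-combine) renaming (_≟_ to _≟ᶠ_)
open import Data.Vec using ([]; _∷_; lookup; tabulate; _[_]≔_)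
open import Data.Vec.Properties using (≡-dec; lookup∘tabulate; lookup∘update; lookup∘update′; []≔-idempotent; []≔-lookup)
open import Data.List using (List; []; _∷_; map; _++_; concatMap; filter; allFin)
open import Data.List.Properties using (map-tabulate)
open import Data.List.Relation.Unary.Any using (Any; here; there; any?)
open import Data.List.Membership.Propositional using (_∈_; find; lose)
open import Data.List.Membership.Propositional.Properties
  using (∈-allFin; ∈-map⁺; ∈-++⁺ˡ; ∈-++⁺ʳ; ∈-filter⁺; ∈-filter⁻; ∈-concatMap⁺)
open import Data.Rational using (ℚ; 0ℚ; 1ℚ; _+_; _*_; -_; _-_; _≤_; _<_; _⊓_; _⊔_; 1/_; ≢-nonZero; positive; negative; nonNegative; nonPositive)
open import Data.Rational.Properties
open import Data.Rational.Solver using (module +-*-Solver)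
open import Data.Bool using (true; false; if_then_else_) renaming (_≟_ to _≟ᵇ_)
open import Data.Bool.Properties using (¬-not)
open import Data.Product using (∃; _×_; _,_; proj₁; proj₂)
open import Data.Sum using (_⊎_; inj₁; inj₂)
import Data.Sum as Sum
open import Data.Empty using (⊥-elim)
open import Data.Vec.Functional using () renaming (_∷_ to _∷ᶠ_)
open import Function using (_∘_; id)
open import Relation.Nullary using (¬_; Dec; yes; no; does)
open import Relation.Nullary.Decidable using (map′; dec-true; dec-false; decidable-stable; _×-dec_)
open import Relation.Unary using (Pred; Decidable)
open import Level using (0ℓ)
open import Relation.Binary.PropositionalEquality
open import Relation.Binary.Definitions using (Tri; tri<; tri≈; tri>)
open +-*-Solver

-- Rational arithmetic

p≤q⇒0≤q-p : ∀ {p q} → p ≤ q → 0ℚ ≤ q - p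
p≤q⇒0≤q-p {p} p≤q = ≤-trans (≤-reflexive (sym (+-inverseʳ p))) (+-monoˡ-≤ (- p) p≤q)

p<q⇒0<q-p : ∀ {p q} → p < q → 0ℚ < q - p
p<q⇒0<q-p {p} p<q = ≤-<-trans (≤-reflexive (sym (+-inverseʳ p))) (+-monoˡ-< (- p) p<q)

0≤q-p⇒p≤q : ∀ {p q} → 0ℚ ≤ q - p → p ≤ q
0≤q-p⇒p≤q {p} {q} 0≤q-p = begin
  p            ≡⟨ sym (+-identityˡ p) ⟩
  0ℚ + p       ≤⟨ +-monoˡ-≤ p 0≤q-p ⟩
  q - p + p    ≡⟨ solve 2 (λ p q → q :- p :+ p := q) refl p q ⟩
  q            ∎
  where open ≤-Reasoning

p≤q-r⇒p+r≤q : ∀ {p q r} → p ≤ q - r → p + r ≤ q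
p≤q-r⇒p+r≤q {p} {q} {r} p≤q-r = begin
  p + r        ≤⟨ +-monoˡ-≤ r p≤q-r ⟩
  q - r + r    ≡⟨ solve 2 (λ q r → q :- r :+ r := q) refl q r ⟩
  q            ∎
  where open ≤-Reasoning

neg-cancel-≤ : ∀ {p q} → - p ≤ - q → q ≤ p
neg-cancel-≤ {p} {q} -p≤-q = begin
  q          ≡⟨ solve 1 (λ q → q := :- (:- q)) refl q ⟩
  - (- q)    ≤⟨ neg-antimono-≤ -p≤-q ⟩
  - (- p)    ≡⟨ solve 1 (λ p → :- (:- p) := p) refl p ⟩
  p          ∎
  where open ≤-Reasoning

≤∧≢⇒< : ∀ {p q} → p ≤ q → p ≢ q → p < q
≤∧≢⇒< {p} {q} p≤q p≢q with <-cmp p q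
... | tri< p<q _ _ = p<q
... | tri≈ _ p≡q _ = ⊥-elim (p≢q p≡q)
... | tri> _ _ q<p = ⊥-elim (<-irrefl refl (<-≤-trans q<p p≤q))

p-q<p : ∀ {p q} → 0ℚ < q → p - q < p
p-q<p {p} 0<q = <-≤-trans (+-monoʳ-< p (neg-antimono-< 0<q)) (≤-reflexive (+-identityʳ p))

0≤p+q : ∀ {p q} → 0ℚ ≤ p → 0ℚ ≤ q → 0ℚ ≤ p + q
0≤p+q 0≤p 0≤q = +-mono-≤ 0≤p 0≤q

0≤p*q : ∀ {p q} → 0ℚ ≤ p → 0ℚ ≤ q → 0ℚ ≤ p * q
0≤p*q {p} {q} 0≤p 0≤q = nonNegative⁻¹ (p * q)
  {{nonNeg*nonNeg⇒nonNeg p {{nonNegative 0≤p}} q {{nonNegative 0≤q}}}}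

*-monoˡ-≤ : ∀ {r p q} → 0ℚ ≤ r → p ≤ q → r * p ≤ r * q
*-monoˡ-≤ {r} 0≤r = *-monoˡ-≤-nonNeg r {{nonNegative 0≤r}}

*-monoʳ-≤ : ∀ {r p q} → 0ℚ ≤ r → p ≤ q → p * r ≤ q * r
*-monoʳ-≤ {r} 0≤r = *-monoʳ-≤-nonNeg r {{nonNegative 0≤r}}

≤-fraction-*⇒≤ : ∀ {δ s x} → 0ℚ < δ → 0ℚ ≤ s → s ≤ 1ℚ → δ ≤ s * x → δ ≤ x
≤-fraction-*⇒≤ {δ} {s} {x} 0<δ 0≤s s≤1 δ≤sx = by-cases (0ℚ ≤? x)
  where
  open ≤-Reasoning
  by-cases : Dec (0ℚ ≤ x) → δ ≤ x
  by-cases (yes 0≤x) = begin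
    δ        ≤⟨ δ≤sx ⟩
    s * x    ≤⟨ *-monoʳ-≤ 0≤x s≤1 ⟩
    1ℚ * x   ≡⟨ *-identityˡ x ⟩
    x        ∎
  by-cases (no 0≰x) = ⊥-elim (<-irrefl refl (begin-strict
    0ℚ       <⟨ 0<δ ⟩
    δ        ≤⟨ δ≤sx ⟩
    s * x    ≤⟨ *-monoˡ-≤ 0≤s (<⇒≤ (≰⇒> 0≰x)) ⟩
    s * 0ℚ   ≡⟨ *-zeroʳ s ⟩
    0ℚ       ∎))

-- Finite sums

private
  variable
    X Y I : Set

∑ : List X → (X → ℚ) → ℚ
∑ xs f = sumℚ (map f xs)

∑-cong : ∀ (xs : List X) {f g : X → ℚ} → (∀ x → f x ≡ g x) → ∑ xs f ≡ ∑ xs g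
∑-cong []       f≗g = refl
∑-cong (x ∷ xs) f≗g = cong₂ _+_ (f≗g x) (∑-cong xs f≗g)

∑-cong-∈ : ∀ (xs : List X) {f g : X → ℚ} → (∀ {x} → x ∈ xs → f x ≡ g x) → ∑ xs f ≡ ∑ xs g
∑-cong-∈ []       f≗g = refl
∑-cong-∈ (x ∷ xs) f≗g = cong₂ _+_ (f≗g (here refl)) (∑-cong-∈ xs (f≗g ∘ there))

∑-++ : ∀ (xs ys : List X) (f : X → ℚ) → ∑ (xs ++ ys) f ≡ ∑ xs f + ∑ ys f
∑-++ []       ys f = sym (+-identityˡ _)
∑-++ (x ∷ xs) ys f = trans (cong (f x +_) (∑-++ xs ys f)) (sym (+-assoc (f x) _ _))

∑-map : (g : Y → X) (xs : List Y) (f : X → ℚ) → ∑ (map g xs) f ≡ ∑ xs (f ∘ g)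
∑-map g []       f = refl
∑-map g (x ∷ xs) f = cong (f (g x) +_) (∑-map g xs f)

∑-concatMap : (g : Y → List X) (xs : List Y) (f : X → ℚ) →
              ∑ (concatMap g xs) f ≡ ∑ xs (λ x → ∑ (g x) f)
∑-concatMap g []       f = refl
∑-concatMap g (x ∷ xs) f =
  trans (∑-++ (g x) (concatMap g xs) f) (cong (∑ (g x) f +_) (∑-concatMap g xs f))

∑-zero : ∀ (xs : List X) → ∑ xs (λ _ → 0ℚ) ≡ 0ℚ
∑-zero []       = refl
∑-zero (x ∷ xs) = trans (+-identityˡ _) (∑-zero xs)

∑-distrib-+ : ∀ (xs : List X) (f g : X → ℚ) → ∑ xs (λ x → f x + g x) ≡ ∑ xs f + ∑ xs g
∑-distrib-+ []       f g = refl
∑-distrib-+ (x ∷ xs) f g = trans (cong (f x + g x +_) (∑-distrib-+ xs f g))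
  (solve 4 (λ a b c d → a :+ b :+ (c :+ d) := a :+ c :+ (b :+ d)) refl (f x) (g x) (∑ xs f) (∑ xs g))

∑-neg : ∀ (xs : List X) (f : X → ℚ) → ∑ xs (λ x → - f x) ≡ - ∑ xs f
∑-neg []       f = refl
∑-neg (x ∷ xs) f = trans (cong (- f x +_) (∑-neg xs f)) (sym (neg-distrib-+ (f x) (∑ xs f)))

∑-*-neg : ∀ (xs : List X) (f g : X → ℚ) → ∑ xs (λ x → f x * - g x) ≡ - ∑ xs (λ x → f x * g x)
∑-*-neg xs f g = trans (∑-cong xs (λ x → sym (neg-distribʳ-* (f x) (g x)))) (∑-neg xs (λ x → f x * g x))

∑-distrib-sub : ∀ (xs : List X) (f g : X → ℚ) → ∑ xs (λ x → f x - g x) ≡ ∑ xs f - ∑ xs g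
∑-distrib-sub xs f g = trans (∑-distrib-+ xs f (λ x → - g x)) (cong (∑ xs f +_) (∑-neg xs g))

*-distribˡ-∑ : ∀ (c : ℚ) (xs : List X) (f : X → ℚ) → c * ∑ xs f ≡ ∑ xs (λ x → c * f x)
*-distribˡ-∑ c []       f = *-zeroʳ c
*-distribˡ-∑ c (x ∷ xs) f = trans (*-distribˡ-+ c (f x) (∑ xs f)) (cong (c * f x +_) (*-distribˡ-∑ c xs f))

*-distribʳ-∑ : ∀ (c : ℚ) (xs : List X) (f : X → ℚ) → ∑ xs f * c ≡ ∑ xs (λ x → f x * c)
*-distribʳ-∑ c xs f = trans (*-comm _ c) (trans (*-distribˡ-∑ c xs f) (∑-cong xs (λ x → *-comm c (f x))))

∑-comm : (xs : List X) (ys : List Y) (f : X → Y → ℚ) →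
         ∑ xs (λ x → ∑ ys (f x)) ≡ ∑ ys (λ y → ∑ xs (λ x → f x y))
∑-comm []       ys f = sym (∑-zero ys)
∑-comm (x ∷ xs) ys f = trans (cong (∑ ys (f x) +_) (∑-comm xs ys f))
  (sym (∑-distrib-+ ys (f x) (λ y → ∑ xs (λ x → f x y))))

∑-mono-≤ : ∀ (xs : List X) {f g : X → ℚ} → (∀ x → f x ≤ g x) → ∑ xs f ≤ ∑ xs g
∑-mono-≤ []       f≤g = ≤-refl
∑-mono-≤ (x ∷ xs) f≤g = +-mono-≤ (f≤g x) (∑-mono-≤ xs f≤g)

∑-nonNeg : ∀ (xs : List X) {f : X → ℚ} → (∀ {x} → x ∈ xs → 0ℚ ≤ f x) → 0ℚ ≤ ∑ xs f
∑-nonNeg []       0≤f = ≤-refl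
∑-nonNeg (x ∷ xs) 0≤f = ≤-trans (≤-reflexive (sym (+-identityˡ 0ℚ))) (+-mono-≤ (0≤f (here refl)) (∑-nonNeg xs (0≤f ∘ there)))

term≤∑ : ∀ {xs : List X} {f : X → ℚ} → (∀ {y} → y ∈ xs → 0ℚ ≤ f y) → ∀ {x} → x ∈ xs → f x ≤ ∑ xs f
term≤∑ {xs = y ∷ xs} {f} 0≤f (here refl) = begin
  f y             ≡⟨ sym (+-identityʳ (f y)) ⟩
  f y + 0ℚ        ≤⟨ +-monoʳ-≤ (f y) (∑-nonNeg xs (0≤f ∘ there)) ⟩
  f y + ∑ xs f    ∎
  where open ≤-Reasoning
term≤∑ {xs = y ∷ xs} {f} 0≤f {x} (there x∈xs) = begin
  f x             ≡⟨ sym (+-identityˡ (f x)) ⟩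
  0ℚ + f x        ≤⟨ +-mono-≤ (0≤f (here refl)) (term≤∑ (0≤f ∘ there) x∈xs) ⟩
  f y + ∑ xs f    ∎
  where open ≤-Reasoning

∑-neg-term : ∀ {xs : List X} {f : X → ℚ} → (∀ {y} → y ∈ xs → f y ≤ 0ℚ) → ∀ {x} → x ∈ xs → f x < 0ℚ → ∑ xs f < 0ℚ
∑-neg-term {xs = xs} {f} f≤0 {x} x∈xs fx<0 = begin-strict
  ∑ xs f                     ≡⟨ solve 1 (λ s → s := :- (:- s)) refl (∑ xs f) ⟩
  - (- ∑ xs f)               ≡⟨ cong -_ (sym (∑-neg xs f)) ⟩
  - ∑ xs (λ y → - f y)       <⟨ neg-antimono-< (<-≤-trans (neg-antimono-< fx<0) (term≤∑ (neg-antimono-≤ ∘ f≤0) x∈xs)) ⟩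
  0ℚ                         ∎
  where open ≤-Reasoning

∑-pos⇒∃-pos : ∀ (xs : List X) {f : X → ℚ} → 0ℚ < ∑ xs f → ∃ λ x → x ∈ xs × 0ℚ < f x
∑-pos⇒∃-pos []       0<0 = ⊥-elim (<-irrefl refl 0<0)
∑-pos⇒∃-pos (x ∷ xs) {f} 0<∑ with 0ℚ <? f x
... | yes 0<fx = x , here refl , 0<fx
... | no  0≮fx with ∑-pos⇒∃-pos xs (<-≤-trans 0<∑ (begin
        f x + ∑ xs f  ≤⟨ +-monoˡ-≤ (∑ xs f) (≮⇒≥ 0≮fx) ⟩
        0ℚ + ∑ xs f   ≡⟨ +-identityˡ _ ⟩
        ∑ xs f        ∎))
  where open ≤-Reasoning
...   | y , y∈xs , 0<fy = y , there y∈xs , 0<fy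

mask : ∀ {P : Pred X 0ℓ} → Decidable P → (X → ℚ) → X → ℚ
mask P? f x = if does (P? x) then f x else 0ℚ

∑-filter : ∀ {P : Pred X 0ℓ} (P? : Decidable P) (xs : List X) (f : X → ℚ) →
           ∑ (filter P? xs) f ≡ ∑ xs (mask P? f)
∑-filter P? []       f = refl
∑-filter P? (x ∷ xs) f with does (P? x)
... | true  = cong (f x +_) (∑-filter P? xs f)
... | false = trans (∑-filter P? xs f) (sym (+-identityˡ _))

mask-nonNeg : ∀ {P : Pred X 0ℓ} (P? : Decidable P) {f : X → ℚ} → (∀ x → 0ℚ ≤ f x) → ∀ x → 0ℚ ≤ mask P? f x
mask-nonNeg P? 0≤f x with does (P? x)
... | true  = 0≤f x
... | false = ≤-refl

mask-yes : ∀ {P : Pred X 0ℓ} (P? : Decidable P) {f : X → ℚ} {x} → P x → mask P? f x ≡ f x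
mask-yes P? {f} {x} Px = cong (λ b → if b then f x else 0ℚ) (dec-true (P? x) Px)

mask-no : ∀ {P : Pred X 0ℓ} (P? : Decidable P) {f : X → ℚ} {x} → ¬ P x → mask P? f x ≡ 0ℚ
mask-no P? {f} {x} ¬Px = cong (λ b → if b then f x else 0ℚ) (dec-false (P? x) ¬Px)

mask-support : ∀ {P : Pred X 0ℓ} (P? : Decidable P) {f : X → ℚ} {x} → mask P? f x ≢ 0ℚ → P x
mask-support P? {f} {x} mask≢0 = decidable-stable (P? x) (mask≢0 ∘ mask-no P? {f})

∑-mask-* : ∀ {P : Pred X 0ℓ} (P? : Decidable P) (xs : List X) (f v : X → ℚ) →
           ∑ xs (λ x → mask P? f x * v x) ≡ ∑ (filter P? xs) (λ x → f x * v x)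
∑-mask-* P? xs f v = trans (∑-cong xs mask-*) (sym (∑-filter P? xs (λ x → f x * v x)))
  where
  mask-* : ∀ x → mask P? f x * v x ≡ mask P? (λ y → f y * v y) x
  mask-* x with does (P? x)
  ... | true  = refl
  ... | false = *-zeroˡ (v x)

∑-filter-⊆ : ∀ {P Q : Pred X 0ℓ} (P? : Decidable P) (Q? : Decidable Q) (xs : List X) {f : X → ℚ} →
             (∀ {x} → P x → Q x) → (∀ x → 0ℚ ≤ f x) → ∑ (filter P? xs) f ≤ ∑ (filter Q? xs) f
∑-filter-⊆ P? Q? []       P⇒Q 0≤f = ≤-refl
∑-filter-⊆ P? Q? (x ∷ xs) {f} P⇒Q 0≤f with P? x | Q? x
... | yes Px | yes _   = +-monoʳ-≤ (f x) (∑-filter-⊆ P? Q? xs P⇒Q 0≤f)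
... | yes Px | no ¬Qx  = ⊥-elim (¬Qx (P⇒Q Px))
... | no  _  | yes _   = ≤-trans (≤-reflexive (sym (+-identityˡ _))) (+-mono-≤ (0≤f x) (∑-filter-⊆ P? Q? xs P⇒Q 0≤f))
... | no  _  | no  _   = ∑-filter-⊆ P? Q? xs P⇒Q 0≤f

∑-allFin-suc : ∀ n (f : Fin (suc n) → ℚ) → ∑ (allFin (suc n)) f ≡ f zero + ∑ (allFin n) (f ∘ suc)
∑-allFin-suc n f = cong (λ xs → f zero + sumℚ xs) (trans (map-tabulate suc f) (sym (map-tabulate id (f ∘ suc))))

∑-allFin-+ : ∀ m n (f : Fin (m ℕ.+ n) → ℚ) →
             ∑ (allFin (m ℕ.+ n)) f ≡ ∑ (allFin m) (λ i → f (i ↑ˡ n)) + ∑ (allFin n) (λ j → f (m ↑ʳ j))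
∑-allFin-+ zero    n f = sym (+-identityˡ _)
∑-allFin-+ (suc m) n f = begin
  ∑ (allFin (suc m ℕ.+ n)) f                                                  ≡⟨ ∑-allFin-suc (m ℕ.+ n) f ⟩
  f zero + ∑ (allFin (m ℕ.+ n)) (f ∘ suc)                                     ≡⟨ cong (f zero +_) (∑-allFin-+ m n (f ∘ suc)) ⟩
  f zero + (∑ (allFin m) (λ i → f (suc i ↑ˡ n)) + ∑ (allFin n) (λ j → f (suc m ↑ʳ j)))
    ≡⟨ sym (+-assoc (f zero) _ _) ⟩
  f zero + ∑ (allFin m) (λ i → f (suc i ↑ˡ n)) + ∑ (allFin n) (λ j → f (suc m ↑ʳ j))
    ≡⟨ cong (_+ ∑ (allFin n) (λ j → f (suc m ↑ʳ j))) (sym (∑-allFin-suc m (λ i → f (i ↑ˡ n)))) ⟩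
  ∑ (allFin (suc m)) (λ i → f (i ↑ˡ n)) + ∑ (allFin n) (λ j → f (suc m ↑ʳ j)) ∎
  where open ≡-Reasoning

∑-allFin-combine : ∀ m n (f : Fin (m ℕ.* n) → ℚ) →
                   ∑ (allFin (m ℕ.* n)) f ≡ ∑ (allFin m) (λ i → ∑ (allFin n) (λ j → f (combine i j)))
∑-allFin-combine zero    n f = refl
∑-allFin-combine (suc m) n f = begin
  ∑ (allFin (n ℕ.+ m ℕ.* n)) f
    ≡⟨ ∑-allFin-+ n (m ℕ.* n) f ⟩
  ∑ (allFin n) (λ j → f (j ↑ˡ m ℕ.* n)) + ∑ (allFin (m ℕ.* n)) (λ t → f (n ↑ʳ t))
    ≡⟨ cong (∑ (allFin n) (λ j → f (j ↑ˡ m ℕ.* n)) +_) (∑-allFin-combine m n (λ t → f (n ↑ʳ t))) ⟩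
  ∑ (allFin n) (λ j → f (j ↑ˡ m ℕ.* n)) + ∑ (allFin m) (λ i → ∑ (allFin n) (λ j → f (n ↑ʳ combine i j)))
    ≡⟨ sym (∑-allFin-suc m (λ i → ∑ (allFin n) (λ j → f (combine i j)))) ⟩
  ∑ (allFin (suc m)) (λ i → ∑ (allFin n) (λ j → f (combine i j))) ∎
  where open ≡-Reasoning

ℕtoℚ-suc : ∀ m → ℕtoℚ (suc m) ≡ 1ℚ + ℕtoℚ m
ℕtoℚ-suc m = sym (trans (cong (1ℚ +_) (normalize-coprime 1-coprime))
  (/-cong {p₁ = (ℤ.+ 1) ℤ.* (ℤ.+ 1) ℤ.+ (ℤ.+ m) ℤ.* (ℤ.+ 1)} {q₁ = 1} (cong (λ k → (ℤ.+ 1) ℤ.+ k) (ℤ.*-identityʳ (ℤ.+ m))) refl))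
  where 1-coprime = Coprimality.sym (Coprimality.1-coprimeTo m)

∑-allFin-1 : ∀ n → ∑ (allFin n) (λ _ → 1ℚ) ≡ ℕtoℚ n
∑-allFin-1 zero    = refl
∑-allFin-1 (suc n) = trans (∑-allFin-suc n (λ _ → 1ℚ)) (trans (cong (1ℚ +_) (∑-allFin-1 n)) (sym (ℕtoℚ-suc n)))

opaque
  kronecker : ∀ {n} → Fin n → Fin n → ℚ
  kronecker a b = if does (a ≟ᶠ b) then 1ℚ else 0ℚ

  kronecker-≡-* : ∀ {n} {a b : Fin n} → a ≡ b → ∀ p → kronecker a b * p ≡ p
  kronecker-≡-* {a = a} {b} a≡b p = trans (cong (λ t → (if t then 1ℚ else 0ℚ) * p) (dec-true (a ≟ᶠ b) a≡b)) (*-identityˡ p)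

  kronecker-≢-* : ∀ {n} {a b : Fin n} → a ≢ b → ∀ p → kronecker a b * p ≡ 0ℚ
  kronecker-≢-* {a = a} {b} a≢b p = trans (cong (λ t → (if t then 1ℚ else 0ℚ) * p) (dec-false (a ≟ᶠ b) a≢b)) (*-zeroˡ p)

  kronecker-suc : ∀ {n} (a b : Fin n) → kronecker (suc a) (suc b) ≡ kronecker a b
  kronecker-suc a b = refl

  kronecker-sym : ∀ {n} (a b : Fin n) → kronecker a b ≡ kronecker b a
  kronecker-sym a b = cong (λ t → if t then 1ℚ else 0ℚ) does-sym
    where
    does-sym : does (a ≟ᶠ b) ≡ does (b ≟ᶠ a)
    does-sym with a ≟ᶠ b | b ≟ᶠ a
    ... | yes _   | yes _   = refl
    ... | no  _   | no  _   = refl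
    ... | yes a≡b | no  b≢a = ⊥-elim (b≢a (sym a≡b))
    ... | no  a≢b | yes b≡a = ⊥-elim (a≢b (sym b≡a))

  mask-≟ : ∀ {n} (f : X → Fin n) (j : Fin n) (K : X → ℚ) x → mask (λ y → f y ≟ᶠ j) K x ≡ kronecker (f x) j * K x
  mask-≟ f j K x with does (f x ≟ᶠ j)
  ... | true  = sym (*-identityˡ (K x))
  ... | false = sym (*-zeroˡ (K x))

∑-kronecker : ∀ n (a : Fin n) (g : Fin n → ℚ) → ∑ (allFin n) (λ b → kronecker a b * g b) ≡ g a
∑-kronecker (suc n) zero    g = begin
  ∑ (allFin (suc n)) (λ b → kronecker zero b * g b)                ≡⟨ ∑-allFin-suc n (λ b → kronecker zero b * g b) ⟩
  kronecker zero zero * g zero + ∑ (allFin n) (λ b → kronecker zero (suc b) * g (suc b))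
    ≡⟨ cong₂ _+_ (kronecker-≡-* refl (g zero)) (∑-cong (allFin n) (λ b → kronecker-≢-* (λ ()) (g (suc b)))) ⟩
  g zero + ∑ (allFin n) (λ _ → 0ℚ)                                 ≡⟨ cong (g zero +_) (∑-zero (allFin n)) ⟩
  g zero + 0ℚ                                                      ≡⟨ +-identityʳ (g zero) ⟩
  g zero                                                           ∎
  where open ≡-Reasoning
∑-kronecker (suc n) (suc a) g = begin
  ∑ (allFin (suc n)) (λ b → kronecker (suc a) b * g b)             ≡⟨ ∑-allFin-suc n (λ b → kronecker (suc a) b * g b) ⟩
  kronecker (suc a) zero * g zero + ∑ (allFin n) (λ b → kronecker (suc a) (suc b) * g (suc b))
    ≡⟨ cong₂ _+_ (kronecker-≢-* (λ ()) (g zero)) (∑-cong (allFin n) (λ b → cong (_* g (suc b)) (kronecker-suc a b))) ⟩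
  0ℚ + ∑ (allFin n) (λ b → kronecker a b * g (suc b))              ≡⟨ +-identityˡ _ ⟩
  ∑ (allFin n) (λ b → kronecker a b * g (suc b))                   ≡⟨ ∑-kronecker n a (g ∘ suc) ⟩
  g (suc a)                                                        ∎
  where open ≡-Reasoning

-- Farkas' lemma by Fourier–Motzkin elimination

recip : ℚ → ℚ
recip p with p ≟ 0ℚ
... | yes _   = 0ℚ
... | no  p≢0 = (1/ p) {{≢-nonZero p≢0}}

*-recip : ∀ p → p ≢ 0ℚ → p * recip p ≡ 1ℚ
*-recip p p≢0 with p ≟ 0ℚ
... | yes p≡0  = ⊥-elim (p≢0 p≡0)
... | no  p≢0′ = *-inverseʳ p {{≢-nonZero p≢0′}}

recip-pos : ∀ {p} → 0ℚ < p → 0ℚ < recip p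
recip-pos {p} 0<p with p ≟ 0ℚ
... | yes p≡0 = ⊥-elim (<-irrefl (sym p≡0) 0<p)
... | no  _   = positive⁻¹ _ {{1/pos⇒pos p {{positive 0<p}}}}

recip-neg : ∀ {p} → p < 0ℚ → recip p < 0ℚ
recip-neg {p} p<0 with p ≟ 0ℚ
... | yes p≡0 = ⊥-elim (<-irrefl p≡0 p<0)
... | no  _   = negative⁻¹ _ {{1/neg⇒neg p {{negative p<0}}}}

*-r*recip : ∀ {c} r → c ≢ 0ℚ → c * (r * recip c) ≡ r
*-r*recip {c} r c≢0 = begin
  c * (r * recip c)   ≡⟨ solve 3 (λ c r i → c :* (r :* i) := r :* (c :* i)) refl c r (recip c) ⟩
  r * (c * recip c)   ≡⟨ cong (r *_) (*-recip c c≢0) ⟩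
  r * 1ℚ              ≡⟨ *-identityʳ r ⟩
  r                   ∎
  where open ≡-Reasoning

pos-*-≤ : ∀ {c x r} → 0ℚ < c → x ≤ r * recip c → c * x ≤ r
pos-*-≤ {c} {x} {r} 0<c x≤r/c = ≤-trans (*-monoˡ-≤ (<⇒≤ 0<c) x≤r/c) (≤-reflexive (*-r*recip r (≢-sym (<⇒≢ 0<c))))

neg-*-≤ : ∀ {c x r} → c < 0ℚ → r * recip c ≤ x → c * x ≤ r
neg-*-≤ {c} {x} {r} c<0 r/c≤x =
  ≤-trans (*-monoˡ-≤-nonPos c {{nonPositive (<⇒≤ c<0)}} r/c≤x) (≤-reflexive (*-r*recip r (<⇒≢ c<0)))

lowerBound : (U : Y → ℚ) (bs : List Y) → ∃ λ x → ∀ {b} → b ∈ bs → x ≤ U b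
lowerBound U []       = 0ℚ , λ ()
lowerBound U (b ∷ bs) with lowerBound U bs
... | x , x≤U = U b ⊓ x , λ { (here refl) → p⊓q≤p (U b) x ; (there b∈bs) → ≤-trans (p⊓q≤q (U b) x) (x≤U b∈bs) }

separate : (L : X → ℚ) (U : Y → ℚ) (as : List X) (bs : List Y) →
           (∀ {a b} → a ∈ as → b ∈ bs → L a ≤ U b) →
           ∃ λ x → (∀ {a} → a ∈ as → L a ≤ x) × (∀ {b} → b ∈ bs → x ≤ U b)
separate L U []       bs L≤U = proj₁ (lowerBound U bs) , (λ ()) , proj₂ (lowerBound U bs)
separate L U (a ∷ as) bs L≤U with separate L U as bs (L≤U ∘ there)
... | x , L≤x , x≤U = L a ⊔ x
  , (λ { (here refl) → p≤p⊔q (L a) x ; (there a′∈as) → ≤-trans (L≤x a′∈as) (p≤q⊔p (L a) x) })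
  , (λ b∈bs → ⊔-lub (L≤U (here refl) b∈bs) (x≤U b∈bs))

record Inequality (k : ℕ) : Set where
  field
    coeff : Fin k → ℚ
    bound : ℚ

open Inequality

infix 8 _·_
_·_ : ∀ {k} → (Fin k → ℚ) → (Fin k → ℚ) → ℚ
_·_ {k} a x = ∑ (allFin k) (λ t → a t * x t)

·-linear : ∀ {k} (α β : ℚ) (a b x : Fin k → ℚ) → (λ t → α * a t + β * b t) · x ≡ α * (a · x) + β * (b · x)
·-linear {k} α β a b x = begin
  ∑ (allFin k) (λ t → (α * a t + β * b t) * x t)
    ≡⟨ ∑-cong (allFin k) (λ t → distrib α β (a t) (b t) (x t)) ⟩
  ∑ (allFin k) (λ t → α * (a t * x t) + β * (b t * x t))
    ≡⟨ ∑-distrib-+ (allFin k) _ _ ⟩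
  ∑ (allFin k) (λ t → α * (a t * x t)) + ∑ (allFin k) (λ t → β * (b t * x t))
    ≡⟨ sym (cong₂ _+_ (*-distribˡ-∑ α (allFin k) _) (*-distribˡ-∑ β (allFin k) _)) ⟩
  α * (a · x) + β * (b · x) ∎
  where
  open ≡-Reasoning
  distrib : ∀ α β a b x → (α * a + β * b) * x ≡ α * (a * x) + β * (b * x)
  distrib = solve 5 (λ α β a b x → (α :* a :+ β :* b) :* x := α :* (a :* x) :+ β :* (b :* x)) refl

·-neg : ∀ {k} (a x : Fin k → ℚ) → (λ t → - a t) · x ≡ - (a · x)
·-neg {k} a x = trans (∑-cong (allFin k) (λ t → sym (neg-distribˡ-* (a t) (x t)))) (∑-neg (allFin k) (λ t → a t * x t))

Solves : ∀ {k} → List I → (I → Inequality k) → (Fin k → ℚ) → Set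
Solves rows R x = ∀ {i} → i ∈ rows → coeff (R i) · x ≤ bound (R i)

record FarkasCertificate {k} (rows : List I) (R : I → Inequality k) : Set where
  field
    multiplier        : I → ℚ
    multiplier-nonNeg : ∀ i → 0ℚ ≤ multiplier i
    combination-coeff : ∀ t → ∑ rows (λ i → multiplier i * coeff (R i) t) ≡ 0ℚ
    combination-bound : ∑ rows (λ i → multiplier i * bound (R i)) < 0ℚ

farkas-0 : (rows : List I) (R : I → Inequality 0) → ∃ (Solves rows R) ⊎ FarkasCertificate rows R
farkas-0 rows R = by-cases (any? negative? rows)
  where
  negative? = λ i → bound (R i) <? 0ℚ

  certificate : ∀ {i₀} → i₀ ∈ rows → bound (R i₀) < 0ℚ → FarkasCertificate rows R
  certificate i₀∈rows b<0 = record
    { multiplier        = mask negative? (λ _ → 1ℚ)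
    ; multiplier-nonNeg = mask-nonNeg negative? (λ _ → nonNegative⁻¹ 1ℚ)
    ; combination-coeff = λ ()
    ; combination-bound = begin-strict
        ∑ rows (λ i → mask negative? (λ _ → 1ℚ) i * bound (R i))  ≡⟨ ∑-mask-* negative? rows (λ _ → 1ℚ) (bound ∘ R) ⟩
        ∑ (filter negative? rows) (λ i → 1ℚ * bound (R i))        <⟨ ∑-neg-term (<⇒≤ ∘ neg) i₀∈negs (neg i₀∈negs) ⟩
        0ℚ                                                        ∎
    }
    where
    open ≤-Reasoning
    neg : ∀ {i} → i ∈ filter negative? rows → 1ℚ * bound (R i) < 0ℚ
    neg i∈ = ≤-<-trans (≤-reflexive (*-identityˡ _)) (proj₂ (∈-filter⁻ negative? {xs = rows} i∈))
    i₀∈negs = ∈-filter⁺ negative? i₀∈rows b<0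

  by-cases : Dec (Any (λ i → bound (R i) < 0ℚ) rows) → ∃ (Solves rows R) ⊎ FarkasCertificate rows R
  by-cases (no ¬any) = inj₁ ((λ ()) , λ i∈rows → ≮⇒≥ (¬any ∘ lose i∈rows))
  by-cases (yes any) = let _ , i₀∈rows , b<0 = find any in inj₂ (certificate i₀∈rows b<0)

-- The first variable is eliminated by keeping the rows in which its coefficient c vanishes and adding,
-- for every row p with c p > 0 and row q with c q < 0, the combination (− c q)·p + (c p)·q.
module Elimination {k} (rows : List I) (R : I → Inequality (suc k)) where

  c : I → ℚ
  c i = coeff (R i) zero

  Z? = λ i → c i ≟ 0ℚ
  P? = λ i → 0ℚ <? c i
  N? = λ i → c i <? 0ℚ

  Zs Ps Ns : List I
  Zs = filter Z? rows
  Ps = filter P? rows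
  Ns = filter N? rows

  rows′ : List (I ⊎ I × I)
  rows′ = map inj₁ Zs ++ concatMap (λ p → map (λ q → inj₂ (p , q)) Ns) Ps

  reduce : (I → ℚ) → I ⊎ I × I → ℚ
  reduce v (inj₁ i)       = v i
  reduce v (inj₂ (p , q)) = (- c q) * v p + c p * v q

  R′ : I ⊎ I × I → Inequality k
  R′ i′ = record { coeff = λ t → reduce (λ i → coeff (R i) (suc t)) i′ ; bound = reduce (bound ∘ R) i′ }

  inj₁∈rows′ : ∀ {i} → i ∈ rows → c i ≡ 0ℚ → inj₁ i ∈ rows′
  inj₁∈rows′ i∈rows ci≡0 = ∈-++⁺ˡ (∈-map⁺ inj₁ (∈-filter⁺ Z? i∈rows ci≡0))

  inj₂∈rows′ : ∀ {p q} → p ∈ Ps → q ∈ Ns → inj₂ (p , q) ∈ rows′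
  inj₂∈rows′ p∈Ps q∈Ns = ∈-++⁺ʳ (map inj₁ Zs) (∈-concatMap⁺ _ (lose p∈Ps (∈-map⁺ _ q∈Ns)))

  ∑-rows′ : ∀ (μ′ : I ⊎ I × I → ℚ) (v : I → ℚ) →
            ∑ rows′ (λ i′ → μ′ i′ * reduce v i′)
            ≡ ∑ Zs (λ i → μ′ (inj₁ i) * v i) + ∑ Ps (λ p → ∑ Ns (λ q → μ′ (inj₂ (p , q)) * reduce v (inj₂ (p , q))))
  ∑-rows′ μ′ v = trans (∑-++ (map inj₁ Zs) _ _) (cong₂ _+_ (∑-map inj₁ Zs _)
    (trans (∑-concatMap (λ p → map (λ q → inj₂ (p , q)) Ns) Ps _) (∑-cong Ps (λ p → ∑-map (λ q → inj₂ (p , q)) Ns _))))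

  module Lift (cert′ : FarkasCertificate rows′ R′) where
    open FarkasCertificate cert′ renaming
      (multiplier to μ′; multiplier-nonNeg to μ′-nonNeg; combination-coeff to coeff′≡0; combination-bound to bound′<0)

    μP μN : I → ℚ
    μP p = ∑ Ns (λ q → μ′ (inj₂ (p , q)) * (- c q))
    μN q = ∑ Ps (λ p → μ′ (inj₂ (p , q)) * c p)

    μ : I → ℚ
    μ i = mask Z? (μ′ ∘ inj₁) i + mask P? μP i + mask N? μN i

    ∑-pairs : ∀ v → ∑ Ps (λ p → μP p * v p) + ∑ Ns (λ q → μN q * v q)
                    ≡ ∑ Ps (λ p → ∑ Ns (λ q → μ′ (inj₂ (p , q)) * reduce v (inj₂ (p , q))))
    ∑-pairs v = sym (begin
      ∑ Ps (λ p → ∑ Ns (λ q → μ′ (inj₂ (p , q)) * ((- c q) * v p + c p * v q)))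
        ≡⟨ ∑-cong Ps (λ p → trans (∑-cong Ns (λ q → distrib (μ′ (inj₂ (p , q))) (c q) (c p) (v p) (v q))) (∑-distrib-+ Ns _ _)) ⟩
      ∑ Ps (λ p → ∑ Ns (λ q → μ′ (inj₂ (p , q)) * (- c q) * v p) + ∑ Ns (λ q → μ′ (inj₂ (p , q)) * c p * v q))
        ≡⟨ ∑-distrib-+ Ps _ _ ⟩
      ∑ Ps (λ p → ∑ Ns (λ q → μ′ (inj₂ (p , q)) * (- c q) * v p)) + ∑ Ps (λ p → ∑ Ns (λ q → μ′ (inj₂ (p , q)) * c p * v q))
        ≡⟨ cong₂ _+_ (∑-cong Ps (λ p → sym (*-distribʳ-∑ (v p) Ns _)))
                     (trans (∑-comm Ps Ns _) (∑-cong Ns (λ q → sym (*-distribʳ-∑ (v q) Ps _)))) ⟩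
      ∑ Ps (λ p → μP p * v p) + ∑ Ns (λ q → μN q * v q) ∎)
      where
      open ≡-Reasoning
      distrib : ∀ m a b x y → m * ((- a) * x + b * y) ≡ m * (- a) * x + m * b * y
      distrib = solve 5 (λ m a b x y → m :* ((:- a) :* x :+ b :* y) := m :* (:- a) :* x :+ m :* b :* y) refl

    ∑-μ : ∀ v → ∑ rows (λ i → μ i * v i) ≡ ∑ rows′ (λ i′ → μ′ i′ * reduce v i′)
    ∑-μ v = begin
      ∑ rows (λ i → μ i * v i)
        ≡⟨ ∑-cong rows (λ i → solve 4 (λ z p n v → (z :+ p :+ n) :* v := z :* v :+ p :* v :+ n :* v) refl (mZ i) (mP i) (mN i) (v i)) ⟩
      ∑ rows (λ i → mZ i * v i + mP i * v i + mN i * v i)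
        ≡⟨ trans (∑-distrib-+ rows (λ i → mZ i * v i + mP i * v i) (λ i → mN i * v i))
                 (cong (_+ ∑ rows (λ i → mN i * v i)) (∑-distrib-+ rows (λ i → mZ i * v i) (λ i → mP i * v i))) ⟩
      ∑ rows (λ i → mZ i * v i) + ∑ rows (λ i → mP i * v i) + ∑ rows (λ i → mN i * v i)
        ≡⟨ cong₂ _+_ (cong₂ _+_ (∑-mask-* Z? rows (μ′ ∘ inj₁) v) (∑-mask-* P? rows μP v)) (∑-mask-* N? rows μN v) ⟩
      ∑ Zs (λ i → μ′ (inj₁ i) * v i) + ∑ Ps (λ p → μP p * v p) + ∑ Ns (λ q → μN q * v q)
        ≡⟨ trans (+-assoc (∑ Zs (λ i → μ′ (inj₁ i) * v i)) _ _) (cong (∑ Zs (λ i → μ′ (inj₁ i) * v i) +_) (∑-pairs v)) ⟩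
      ∑ Zs (λ i → μ′ (inj₁ i) * v i) + ∑ Ps (λ p → ∑ Ns (λ q → μ′ (inj₂ (p , q)) * reduce v (inj₂ (p , q))))
        ≡⟨ sym (∑-rows′ μ′ v) ⟩
      ∑ rows′ (λ i′ → μ′ i′ * reduce v i′) ∎
      where
      open ≡-Reasoning
      mZ = mask Z? (μ′ ∘ inj₁)
      mP = mask P? μP
      mN = mask N? μN

    μ-nonNeg : ∀ i → 0ℚ ≤ μ i
    μ-nonNeg i = 0≤p+q (0≤p+q (mask-nonNeg Z? (μ′-nonNeg ∘ inj₁) i) (mask-nonNeg P? μP-nonNeg i)) (mask-nonNeg N? μN-nonNeg i)
      where
      μP-nonNeg : ∀ p → 0ℚ ≤ μP p
      μP-nonNeg p = ∑-nonNeg Ns (λ q∈Ns → 0≤p*q (μ′-nonNeg _) (neg-antimono-≤ (<⇒≤ (proj₂ (∈-filter⁻ N? {xs = rows} q∈Ns)))))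
      μN-nonNeg : ∀ q → 0ℚ ≤ μN q
      μN-nonNeg q = ∑-nonNeg Ps (λ p∈Ps → 0≤p*q (μ′-nonNeg _) (<⇒≤ (proj₂ (∈-filter⁻ P? {xs = rows} p∈Ps))))

    reduce-c≡0 : ∑ rows′ (λ i′ → μ′ i′ * reduce c i′) ≡ 0ℚ
    reduce-c≡0 = begin
      ∑ rows′ (λ i′ → μ′ i′ * reduce c i′)                                       ≡⟨ ∑-rows′ μ′ c ⟩
      ∑ Zs (λ i → μ′ (inj₁ i) * c i) + ∑ Ps (λ p → ∑ Ns (λ q → μ′ (inj₂ (p , q)) * ((- c q) * c p + c p * c q)))
        ≡⟨ cong₂ _+_ (∑-cong-∈ Zs vanish-Zs) (∑-cong Ps (λ p → ∑-cong Ns (λ q → cancel (μ′ (inj₂ (p , q))) (c p) (c q)))) ⟩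
      ∑ Zs (λ _ → 0ℚ) + ∑ Ps (λ _ → ∑ Ns (λ _ → 0ℚ))
        ≡⟨ cong₂ _+_ (∑-zero Zs) (trans (∑-cong Ps (λ _ → ∑-zero Ns)) (∑-zero Ps)) ⟩
      0ℚ ∎
      where
      open ≡-Reasoning
      vanish-Zs : ∀ {i} → i ∈ Zs → μ′ (inj₁ i) * c i ≡ 0ℚ
      vanish-Zs {i} i∈Zs = trans (cong (μ′ (inj₁ i) *_) (proj₂ (∈-filter⁻ Z? {xs = rows} i∈Zs))) (*-zeroʳ (μ′ (inj₁ i)))
      cancel : ∀ m a b → m * ((- b) * a + a * b) ≡ 0ℚ
      cancel = solve 3 (λ m a b → m :* ((:- b) :* a :+ a :* b) := con 0ℚ) refl

    certificate : FarkasCertificate rows R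
    certificate = record
      { multiplier        = μ
      ; multiplier-nonNeg = μ-nonNeg
      ; combination-coeff = λ { zero → trans (∑-μ c) reduce-c≡0 ; (suc t) → trans (∑-μ (λ i → coeff (R i) (suc t))) (coeff′≡0 t) }
      ; combination-bound = ≤-<-trans (≤-reflexive (∑-μ (bound ∘ R))) bound′<0
      }

  module Extend (x : Fin k → ℚ) (solves : Solves rows′ R′ x) where
    slack : I → ℚ
    slack i = bound (R i) - (coeff (R i) ∘ suc) · x

    pair-slack : ∀ {p q} → p ∈ Ps → q ∈ Ns → 0ℚ ≤ (- c q) * slack p + c p * slack q
    pair-slack {p} {q} p∈Ps q∈Ns = ≤-trans (p≤q⇒0≤q-p combined) (≤-reflexive (regroup (c q) (c p) (bound (R p)) (bound (R q)) _ _))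
      where
      combined : (- c q) * ((coeff (R p) ∘ suc) · x) + c p * ((coeff (R q) ∘ suc) · x) ≤ (- c q) * bound (R p) + c p * bound (R q)
      combined = ≤-trans (≤-reflexive (sym (·-linear (- c q) (c p) (coeff (R p) ∘ suc) (coeff (R q) ∘ suc) x)))
                         (solves (inj₂∈rows′ p∈Ps q∈Ns))
      regroup : ∀ b a bp bq dp dq → (- b) * bp + a * bq - ((- b) * dp + a * dq) ≡ (- b) * (bp - dp) + a * (bq - dq)
      regroup = solve 6 (λ b a bp bq dp dq → (:- b) :* bp :+ a :* bq :- ((:- b) :* dp :+ a :* dq) := (:- b) :* (bp :- dp) :+ a :* (bq :- dq)) refl

    lower upper : I → ℚ
    lower q = slack q * recip (c q)
    upper p = slack p * recip (c p)

    lower≤upper : ∀ {q p} → q ∈ Ns → p ∈ Ps → lower q ≤ upper p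
    lower≤upper {q} {p} q∈Ns p∈Ps = 0≤q-p⇒p≤q (begin
      0ℚ
        ≤⟨ 0≤p*q (0≤p*q (<⇒≤ (recip-pos 0<cp)) (neg-antimono-≤ (<⇒≤ (recip-neg cq<0)))) (pair-slack p∈Ps q∈Ns) ⟩
      recip (c p) * (- recip (c q)) * ((- c q) * slack p + c p * slack q)
        ≡⟨ expand (c p) (c q) (recip (c p)) (recip (c q)) (slack p) (slack q) ⟩
      upper p * (c q * recip (c q)) - lower q * (c p * recip (c p))
        ≡⟨ cong₂ (λ u v → upper p * u - lower q * v) (*-recip (c q) (<⇒≢ cq<0)) (*-recip (c p) (≢-sym (<⇒≢ 0<cp))) ⟩
      upper p * 1ℚ - lower q * 1ℚ
        ≡⟨ cong₂ _-_ (*-identityʳ (upper p)) (*-identityʳ (lower q)) ⟩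
      upper p - lower q ∎)
      where
      open ≤-Reasoning
      0<cp = proj₂ (∈-filter⁻ P? {xs = rows} p∈Ps)
      cq<0 = proj₂ (∈-filter⁻ N? {xs = rows} q∈Ns)
      expand : ∀ a b ia ib sp sq → ia * (- ib) * ((- b) * sp + a * sq) ≡ sp * ia * (b * ib) - sq * ib * (a * ia)
      expand = solve 6 (λ a b ia ib sp sq → ia :* (:- ib) :* ((:- b) :* sp :+ a :* sq) := sp :* ia :* (b :* ib) :- sq :* ib :* (a :* ia)) refl

    private
      separated = separate lower upper Ns Ps lower≤upper

    x₀ : ℚ
    x₀ = proj₁ separated

    lower≤x₀ : ∀ {q} → q ∈ Ns → lower q ≤ x₀
    lower≤x₀ = proj₁ (proj₂ separated)

    x₀≤upper : ∀ {p} → p ∈ Ps → x₀ ≤ upper p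
    x₀≤upper = proj₂ (proj₂ separated)

    ·-∷ : ∀ i → coeff (R i) · (x₀ ∷ᶠ x) ≡ c i * x₀ + (coeff (R i) ∘ suc) · x
    ·-∷ i = ∑-allFin-suc k (λ t → coeff (R i) t * (x₀ ∷ᶠ x) t)

    solves-if : ∀ i → c i * x₀ ≤ slack i → coeff (R i) · (x₀ ∷ᶠ x) ≤ bound (R i)
    solves-if i cx₀≤slack = ≤-trans (≤-reflexive (·-∷ i)) (p≤q-r⇒p+r≤q {c i * x₀} {bound (R i)} {(coeff (R i) ∘ suc) · x} cx₀≤slack)

    solution : Solves rows R (x₀ ∷ᶠ x)
    solution {i} i∈rows = by-sign (<-cmp (c i) 0ℚ)
      where
      by-sign : Tri (c i < 0ℚ) (c i ≡ 0ℚ) (0ℚ < c i) → coeff (R i) · (x₀ ∷ᶠ x) ≤ bound (R i)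
      by-sign (tri< ci<0 _ _) = solves-if i (neg-*-≤ ci<0 (lower≤x₀ (∈-filter⁺ N? i∈rows ci<0)))
      by-sign (tri> _ _ 0<ci) = solves-if i (pos-*-≤ 0<ci (x₀≤upper (∈-filter⁺ P? i∈rows 0<ci)))
      by-sign (tri≈ _ ci≡0 _) = begin
        coeff (R i) · (x₀ ∷ᶠ x)                ≡⟨ ·-∷ i ⟩
        c i * x₀ + (coeff (R i) ∘ suc) · x     ≡⟨ cong (λ a → a * x₀ + (coeff (R i) ∘ suc) · x) ci≡0 ⟩
        0ℚ * x₀ + (coeff (R i) ∘ suc) · x      ≡⟨ trans (cong (_+ (coeff (R i) ∘ suc) · x) (*-zeroˡ x₀)) (+-identityˡ _) ⟩
        (coeff (R i) ∘ suc) · x                ≤⟨ solves (inj₁∈rows′ i∈rows ci≡0) ⟩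
        bound (R i)                            ∎
        where open ≤-Reasoning

farkas : ∀ k (rows : List I) (R : I → Inequality k) → ∃ (Solves rows R) ⊎ FarkasCertificate rows R
farkas zero    rows R = farkas-0 rows R
farkas (suc k) rows R =
  Sum.map (λ (x , solves) → Extend.x₀ x solves ∷ᶠ x , Extend.solution x solves) Lift.certificate (farkas k rows′ R′)
  where open Elimination rows R

-- Hyperplane sums, covers and weak duality

∈-allIdx : ∀ {d n} (α : Index d n) → α ∈ allIdx d n
∈-allIdx []      = here refl
∈-allIdx (a ∷ α) = ∈-concatMap⁺ _ (lose (∈-allFin a) (∈-map⁺ (a ∷_) (∈-allIdx α)))

∃?-Index : ∀ {d n} {P : Pred (Index d n) 0ℓ} → Decidable P → Dec (∃ P)
∃?-Index {d} {n} P? = map′ (λ any → let α , _ , Pα = find any in α , Pα) (λ (α , Pα) → lose (∈-allIdx α) Pα) (any? P? (allIdx d n))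

module _ {d n : ℕ} where

  hyperSum-kronecker : ∀ (K : QMatrix d n) i j → hyperSum K i j ≡ ∑ (allIdx d n) (λ α → kronecker (lookup α i) j * K α)
  hyperSum-kronecker K i j = trans (∑-filter (λ α → lookup α i ≟ᶠ j) (allIdx d n) K)
    (∑-cong (allIdx d n) (mask-≟ (λ α → lookup α i) j K))

  total≡∑hyperSum : ∀ (K : QMatrix d n) i → total K ≡ ∑ (allFin n) (hyperSum K i)
  total≡∑hyperSum K i = begin
    ∑ (allIdx d n) K
      ≡⟨ ∑-cong (allIdx d n) (λ α → sym (∑-kronecker n (lookup α i) (λ _ → K α))) ⟩
    ∑ (allIdx d n) (λ α → ∑ (allFin n) (λ j → kronecker (lookup α i) j * K α))
      ≡⟨ ∑-comm (allIdx d n) (allFin n) _ ⟩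
    ∑ (allFin n) (λ j → ∑ (allIdx d n) (λ α → kronecker (lookup α i) j * K α))
      ≡⟨ ∑-cong (allFin n) (λ j → sym (hyperSum-kronecker K i j)) ⟩
    ∑ (allFin n) (hyperSum K i) ∎
    where open ≡-Reasoning

  total≤n : ∀ {K : QMatrix d n} → Fin d → (∀ i j → hyperSum K i j ≤ 1ℚ) → total K ≤ ℕtoℚ n
  total≤n {K} i hyperSum≤1 = begin
    total K                         ≡⟨ total≡∑hyperSum K i ⟩
    ∑ (allFin n) (hyperSum K i)     ≤⟨ ∑-mono-≤ (allFin n) (hyperSum≤1 i) ⟩
    ∑ (allFin n) (λ _ → 1ℚ)         ≡⟨ ∑-allFin-1 n ⟩
    ℕtoℚ n                          ∎
    where open ≤-Reasoning

  ∑-*-coverSum : ∀ (K : QMatrix d n) (Λ : Table d n) →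
    ∑ (allIdx d n) (λ α → K α * coverSum Λ α) ≡ ∑ (allFin d) (λ i → ∑ (allFin n) (λ j → Λ i j * hyperSum K i j))
  ∑-*-coverSum K Λ = begin
    ∑ (allIdx d n) (λ α → K α * ∑ (allFin d) (λ i → Λ i (lookup α i)))
      ≡⟨ ∑-cong (allIdx d n) (λ α → *-distribˡ-∑ (K α) (allFin d) _) ⟩
    ∑ (allIdx d n) (λ α → ∑ (allFin d) (λ i → K α * Λ i (lookup α i)))
      ≡⟨ ∑-comm (allIdx d n) (allFin d) _ ⟩
    ∑ (allFin d) (λ i → ∑ (allIdx d n) (λ α → K α * Λ i (lookup α i)))
      ≡⟨ ∑-cong (allFin d) (λ i → ∑-cong (allIdx d n) (λ α →
           sym (trans (∑-kronecker n (lookup α i) (λ j → Λ i j * K α)) (*-comm (Λ i (lookup α i)) (K α))))) ⟩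
    ∑ (allFin d) (λ i → ∑ (allIdx d n) (λ α → ∑ (allFin n) (λ j → kronecker (lookup α i) j * (Λ i j * K α))))
      ≡⟨ ∑-cong (allFin d) (λ i → ∑-comm (allIdx d n) (allFin n) _) ⟩
    ∑ (allFin d) (λ i → ∑ (allFin n) (λ j → ∑ (allIdx d n) (λ α → kronecker (lookup α i) j * (Λ i j * K α))))
      ≡⟨ ∑-cong (allFin d) (λ i → ∑-cong (allFin n) (λ j → rearrange i j)) ⟩
    ∑ (allFin d) (λ i → ∑ (allFin n) (λ j → Λ i j * hyperSum K i j)) ∎
    where
    open ≡-Reasoning
    rearrange : ∀ i j → ∑ (allIdx d n) (λ α → kronecker (lookup α i) j * (Λ i j * K α)) ≡ Λ i j * hyperSum K i j
    rearrange i j = begin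
      ∑ (allIdx d n) (λ α → kronecker (lookup α i) j * (Λ i j * K α))
        ≡⟨ ∑-cong (allIdx d n) (λ α → solve 3 (λ e l k → e :* (l :* k) := l :* (e :* k)) refl (kronecker (lookup α i) j) (Λ i j) (K α)) ⟩
      ∑ (allIdx d n) (λ α → Λ i j * (kronecker (lookup α i) j * K α))
        ≡⟨ sym (*-distribˡ-∑ (Λ i j) (allIdx d n) _) ⟩
      Λ i j * ∑ (allIdx d n) (λ α → kronecker (lookup α i) j * K α)
        ≡⟨ cong (Λ i j *_) (sym (hyperSum-kronecker K i j)) ⟩
      Λ i j * hyperSum K i j ∎

  K≤K*coverSum : ∀ {A : Matrix01 d n} {K : QMatrix d n} {Λ : Table d n} {α} →
    0ℚ ≤ K α → (K α ≢ 0ℚ → A α ≡ true) → IsHyperplaneCover A Λ → K α ≤ K α * coverSum Λ α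
  K≤K*coverSum {K = K} {Λ} {α} 0≤Kα support (_ , covers) = by-cases (K α ≟ 0ℚ)
    where
    by-cases : Dec (K α ≡ 0ℚ) → K α ≤ K α * coverSum Λ α
    by-cases (yes Kα≡0) = ≤-reflexive (trans Kα≡0 (sym (trans (cong (_* coverSum Λ α) Kα≡0) (*-zeroˡ (coverSum Λ α)))))
    by-cases (no  Kα≢0) = ≤-trans (≤-reflexive (sym (*-identityʳ (K α)))) (*-monoˡ-≤ 0≤Kα (covers α (support Kα≢0)))

  total≤∑-*-coverSum : ∀ {A : Matrix01 d n} {K : QMatrix d n} {Λ : Table d n} →
    (∀ α → 0ℚ ≤ K α) → Contains A K → IsHyperplaneCover A Λ → total K ≤ ∑ (allIdx d n) (λ α → K α * coverSum Λ α)
  total≤∑-*-coverSum {K = K} 0≤K A⊇K cover = ∑-mono-≤ (allIdx d n) (λ α → K≤K*coverSum {K = K} (0≤K α) (A⊇K α) cover)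

  weight-∑-*-coverSum : ∀ (K : QMatrix d n) (Λ : Table d n) →
    weight Λ - ∑ (allIdx d n) (λ α → K α * coverSum Λ α) ≡ ∑ (allFin d) (λ i → ∑ (allFin n) (λ j → Λ i j * (1ℚ - hyperSum K i j)))
  weight-∑-*-coverSum K Λ = begin
    weight Λ - ∑ (allIdx d n) (λ α → K α * coverSum Λ α)
      ≡⟨ cong (λ s → weight Λ - s) (∑-*-coverSum K Λ) ⟩
    weight Λ - ∑ (allFin d) (λ i → ∑ (allFin n) (λ j → Λ i j * hyperSum K i j))
      ≡⟨ sym (∑-distrib-sub (allFin d) _ _) ⟩
    ∑ (allFin d) (λ i → ∑ (allFin n) (Λ i) - ∑ (allFin n) (λ j → Λ i j * hyperSum K i j))
      ≡⟨ ∑-cong (allFin d) (λ i → sym (∑-distrib-sub (allFin n) _ _)) ⟩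
    ∑ (allFin d) (λ i → ∑ (allFin n) (λ j → Λ i j - Λ i j * hyperSum K i j))
      ≡⟨ ∑-cong (allFin d) (λ i → ∑-cong (allFin n) (λ j → factor (Λ i j) (hyperSum K i j))) ⟩
    ∑ (allFin d) (λ i → ∑ (allFin n) (λ j → Λ i j * (1ℚ - hyperSum K i j))) ∎
    where
    open ≡-Reasoning
    factor : ∀ l h → l - l * h ≡ l * (1ℚ - h)
    factor = solve 2 (λ l h → l :- l :* h := l :* (con 1ℚ :- h)) refl

  ∑-*-coverSum≤weight : ∀ {K : QMatrix d n} {Λ : Table d n} → (∀ i j → 0ℚ ≤ Λ i j) → (∀ i j → hyperSum K i j ≤ 1ℚ) →
    ∑ (allIdx d n) (λ α → K α * coverSum Λ α) ≤ weight Λ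
  ∑-*-coverSum≤weight {K} {Λ} 0≤Λ hyperSum≤1 = 0≤q-p⇒p≤q (≤-trans
    (∑-nonNeg (allFin d) (λ {i} _ → ∑-nonNeg (allFin n) (λ {j} _ → 0≤p*q (0≤Λ i j) (p≤q⇒0≤q-p (hyperSum≤1 i j)))))
    (≤-reflexive (sym (weight-∑-*-coverSum K Λ))))

  adjust : Table d n → Fin d → Fin n → ℚ → Table d n
  adjust Λ i j t i′ j′ = Λ i′ j′ + kronecker i i′ * (kronecker j j′ * t)

  adjust-coverSum : ∀ Λ i j t (α : Index d n) → coverSum (adjust Λ i j t) α ≡ coverSum Λ α + kronecker j (lookup α i) * t
  adjust-coverSum Λ i j t α =
    trans (∑-distrib-+ (allFin d) (λ i′ → Λ i′ (lookup α i′)) (λ i′ → kronecker i i′ * (kronecker j (lookup α i′) * t)))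
          (cong (coverSum Λ α +_) (∑-kronecker d i (λ i′ → kronecker j (lookup α i′) * t)))

  adjust-weight : ∀ Λ i j t → weight (adjust Λ i j t) ≡ weight Λ + t
  adjust-weight Λ i j t = begin
    ∑ (allFin d) (λ i′ → ∑ (allFin n) (λ j′ → Λ i′ j′ + kronecker i i′ * (kronecker j j′ * t)))
      ≡⟨ ∑-cong (allFin d) (λ i′ → ∑-distrib-+ (allFin n) _ _) ⟩
    ∑ (allFin d) (λ i′ → ∑ (allFin n) (Λ i′) + ∑ (allFin n) (λ j′ → kronecker i i′ * (kronecker j j′ * t)))
      ≡⟨ ∑-distrib-+ (allFin d) _ _ ⟩
    weight Λ + ∑ (allFin d) (λ i′ → ∑ (allFin n) (λ j′ → kronecker i i′ * (kronecker j j′ * t)))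
      ≡⟨ cong (weight Λ +_) (∑-cong (allFin d) (λ i′ → sym (*-distribˡ-∑ (kronecker i i′) (allFin n) _))) ⟩
    weight Λ + ∑ (allFin d) (λ i′ → kronecker i i′ * ∑ (allFin n) (λ j′ → kronecker j j′ * t))
      ≡⟨ cong (weight Λ +_) (trans (∑-cong (allFin d) (λ i′ → cong (kronecker i i′ *_) (∑-kronecker n j (λ _ → t))))
                                   (∑-kronecker d i (λ _ → t))) ⟩
    weight Λ + t ∎
    where open ≡-Reasoning

  adjust-on : ∀ Λ i j t → adjust Λ i j t i j ≡ Λ i j + t
  adjust-on Λ i j t = cong (Λ i j +_) (trans (kronecker-≡-* refl (kronecker j j * t)) (kronecker-≡-* refl t))

  adjust-off : ∀ Λ {i j} t {i′ j′} → i ≢ i′ ⊎ j ≢ j′ → adjust Λ i j t i′ j′ ≡ Λ i′ j′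
  adjust-off Λ {i} {j} t {i′} {j′} off = trans (cong (Λ i′ j′ +_) (vanish off)) (+-identityʳ (Λ i′ j′))
    where
    vanish : i ≢ i′ ⊎ j ≢ j′ → kronecker i i′ * (kronecker j j′ * t) ≡ 0ℚ
    vanish (inj₁ i≢i′) = kronecker-≢-* i≢i′ (kronecker j j′ * t)
    vanish (inj₂ j≢j′) = trans (cong (kronecker i i′ *_) (kronecker-≢-* j≢j′ t)) (*-zeroʳ (kronecker i i′))

  adjust-nonNeg : ∀ {Λ i j t} → (∀ i′ j′ → 0ℚ ≤ Λ i′ j′) → 0ℚ ≤ Λ i j + t → ∀ i′ j′ → 0ℚ ≤ adjust Λ i j t i′ j′
  adjust-nonNeg {Λ} {i} {j} {t} 0≤Λ 0≤Λij+t i′ j′ = by-position (i ≟ᶠ i′) (j ≟ᶠ j′)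
    where
    by-position : Dec (i ≡ i′) → Dec (j ≡ j′) → 0ℚ ≤ adjust Λ i j t i′ j′
    by-position (yes refl) (yes refl) = ≤-trans 0≤Λij+t (≤-reflexive (sym (adjust-on Λ i j t)))
    by-position (yes _)    (no j≢j′)  = ≤-trans (0≤Λ i′ j′) (≤-reflexive (sym (adjust-off Λ t (inj₂ j≢j′))))
    by-position (no i≢i′)  _          = ≤-trans (0≤Λ i′ j′) (≤-reflexive (sym (adjust-off Λ t (inj₁ i≢i′))))

  optimal-adjust : ∀ {A : Matrix01 d n} {Λ i j t} → IsOptimalCover A Λ → 0ℚ ≤ Λ i j + t →
    (∀ α → A α ≡ true → lookup α i ≡ j → 1ℚ ≤ coverSum Λ α + t) → 0ℚ ≤ t
  optimal-adjust {A} {Λ} {i} {j} {t} ((0≤Λ , covers) , minimal) 0≤Λij+t covers-Γij = begin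
    0ℚ                               ≤⟨ p≤q⇒0≤q-p (≤-trans (minimal (adjust Λ i j t) (adjust-nonNeg 0≤Λ 0≤Λij+t , covers′))
                                                           (≤-reflexive (adjust-weight Λ i j t))) ⟩
    weight Λ + t - weight Λ          ≡⟨ solve 2 (λ w t → w :+ t :- w := t) refl (weight Λ) t ⟩
    t                                ∎
    where
    open ≤-Reasoning
    covers′ : ∀ α → A α ≡ true → 1ℚ ≤ coverSum (adjust Λ i j t) α
    covers′ α Aα with j ≟ᶠ lookup α i
    ... | yes j≡αi = ≤-trans (covers-Γij α Aα (sym j≡αi))
      (≤-reflexive (sym (trans (adjust-coverSum Λ i j t α) (cong (coverSum Λ α +_) (kronecker-≡-* j≡αi t)))))
    ... | no  j≢αi = ≤-trans (covers α Aα)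
      (≤-reflexive (sym (trans (adjust-coverSum Λ i j t α) (trans (cong (coverSum Λ α +_) (kronecker-≢-* j≢αi t)) (+-identityʳ _)))))

  coverSum-[]≔ : ∀ (Λ : Table d n) (α : Index d n) i j → coverSum Λ (α [ i ]≔ j) ≡ coverSum Λ α + (Λ i j - Λ i (lookup α i))
  coverSum-[]≔ Λ α i j = begin
    ∑ (allFin d) (λ i′ → Λ i′ (lookup (α [ i ]≔ j) i′))
      ≡⟨ ∑-cong (allFin d) entry ⟩
    ∑ (allFin d) (λ i′ → Λ i′ (lookup α i′) + kronecker i i′ * (Λ i j - Λ i (lookup α i)))
      ≡⟨ ∑-distrib-+ (allFin d) _ _ ⟩
    coverSum Λ α + ∑ (allFin d) (λ i′ → kronecker i i′ * (Λ i j - Λ i (lookup α i)))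
      ≡⟨ cong (coverSum Λ α +_) (∑-kronecker d i (λ _ → Λ i j - Λ i (lookup α i))) ⟩
    coverSum Λ α + (Λ i j - Λ i (lookup α i)) ∎
    where
    open ≡-Reasoning
    entry : ∀ i′ → Λ i′ (lookup (α [ i ]≔ j) i′) ≡ Λ i′ (lookup α i′) + kronecker i i′ * (Λ i j - Λ i (lookup α i))
    entry i′ with i ≟ᶠ i′
    ... | yes refl = begin
      Λ i (lookup (α [ i ]≔ j) i)                                   ≡⟨ cong (Λ i) (lookup∘update i α j) ⟩
      Λ i j                                                         ≡⟨ solve 2 (λ a b → a := b :+ (a :- b)) refl (Λ i j) (Λ i (lookup α i)) ⟩
      Λ i (lookup α i) + (Λ i j - Λ i (lookup α i))                 ≡⟨ cong (Λ i (lookup α i) +_) (sym (kronecker-≡-* refl _)) ⟩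
      Λ i (lookup α i) + kronecker i i * (Λ i j - Λ i (lookup α i)) ∎
    ... | no i≢i′ = begin
      Λ i′ (lookup (α [ i ]≔ j) i′)                                   ≡⟨ cong (Λ i′) (lookup∘update′ (i≢i′ ∘ sym) α j) ⟩
      Λ i′ (lookup α i′)                                              ≡⟨ sym (+-identityʳ _) ⟩
      Λ i′ (lookup α i′) + 0ℚ                                         ≡⟨ cong (Λ i′ (lookup α i′) +_) (sym (kronecker-≢-* i≢i′ _)) ⟩
      Λ i′ (lookup α i′) + kronecker i i′ * (Λ i j - Λ i (lookup α i)) ∎

  entry≤coverSum : ∀ {Λ : Table d n} → (∀ i j → 0ℚ ≤ Λ i j) → ∀ α i → Λ i (lookup α i) ≤ coverSum Λ α
  entry≤coverSum 0≤Λ α i = term≤∑ (λ {i′} _ → 0≤Λ i′ (lookup α i′)) (∈-allFin i)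

-- Strong duality between hyperplane covers and polyplexes

data CoverConstraint (d n : ℕ) : Set where
  covered     : Index d n → CoverConstraint d n
  nonNeg      : Fin (d ℕ.* n) → CoverConstraint d n
  weightBound : CoverConstraint d n

module CoverLP {d n : ℕ} (A : Matrix01 d n) (w : ℚ) where

  coverCoeff : Index d n → Fin (d ℕ.* n) → ℚ
  coverCoeff α t = kronecker (lookup α (quotient n t)) (remainder {d} n t)

  coverCoeff-combine : ∀ α i j → coverCoeff α (combine i j) ≡ kronecker (lookup α i) j
  coverCoeff-combine α i j = cong (λ (i , j) → kronecker (lookup α i) j) (remQuot-combine {d} {n} i j)

  constraint : CoverConstraint d n → Inequality (d ℕ.* n)
  constraint (covered α) = record { coeff = λ t → - coverCoeff α t ; bound = - 1ℚ }
  constraint (nonNeg s)  = record { coeff = λ t → - kronecker s t  ; bound = 0ℚ }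
  constraint weightBound = record { coeff = λ _ → 1ℚ               ; bound = w }

  A? : Decidable (λ α → A α ≡ true)
  A? α = A α ≟ᵇ true

  support : List (Index d n)
  support = filter A? (allIdx d n)

  constraints : List (CoverConstraint d n)
  constraints = map covered support ++ map nonNeg (allFin (d ℕ.* n)) ++ weightBound ∷ []

  toTable : (Fin (d ℕ.* n) → ℚ) → Table d n
  toTable x i j = x (combine i j)

  coverCoeff-· : ∀ x α → coverCoeff α · x ≡ coverSum (toTable x) α
  coverCoeff-· x α = begin
    ∑ (allFin (d ℕ.* n)) (λ t → coverCoeff α t * x t)
      ≡⟨ ∑-allFin-combine d n _ ⟩
    ∑ (allFin d) (λ i → ∑ (allFin n) (λ j → coverCoeff α (combine i j) * toTable x i j))
      ≡⟨ ∑-cong (allFin d) (λ i → ∑-cong (allFin n) (λ j → cong (_* toTable x i j) (coverCoeff-combine α i j))) ⟩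
    ∑ (allFin d) (λ i → ∑ (allFin n) (λ j → kronecker (lookup α i) j * toTable x i j))
      ≡⟨ ∑-cong (allFin d) (λ i → ∑-kronecker n (lookup α i) (toTable x i)) ⟩
    coverSum (toTable x) α ∎
    where open ≡-Reasoning

  1-· : ∀ x → (λ _ → 1ℚ) · x ≡ weight (toTable x)
  1-· x = trans (∑-cong (allFin (d ℕ.* n)) (λ t → *-identityˡ (x t))) (∑-allFin-combine d n x)

  covered∈ : ∀ {α} → A α ≡ true → covered α ∈ constraints
  covered∈ Aα = ∈-++⁺ˡ (∈-map⁺ covered (∈-filter⁺ A? (∈-allIdx _) Aα))

  nonNeg∈ : ∀ s → nonNeg s ∈ constraints
  nonNeg∈ s = ∈-++⁺ʳ (map covered support) (∈-++⁺ˡ (∈-map⁺ nonNeg (∈-allFin s)))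

  weightBound∈ : weightBound ∈ constraints
  weightBound∈ = ∈-++⁺ʳ (map covered support) (∈-++⁺ʳ (map nonNeg (allFin (d ℕ.* n))) (here refl))

  solution⇒cover : ∀ {x} → Solves constraints constraint x → IsHyperplaneCover A (toTable x) × weight (toTable x) ≤ w
  solution⇒cover {x} solves = (0≤x , covers) , ≤-trans (≤-reflexive (sym (1-· x))) (solves weightBound∈)
    where
    0≤x : ∀ i j → 0ℚ ≤ toTable x i j
    0≤x i j = neg-cancel-≤ (≤-trans (≤-reflexive (sym (trans (·-neg (kronecker (combine i j)) x) (cong -_ (∑-kronecker _ (combine i j) x)))))
                                    (solves (nonNeg∈ (combine i j))))
    covers : ∀ α → A α ≡ true → 1ℚ ≤ coverSum (toTable x) α
    covers α Aα = neg-cancel-≤ (≤-trans (≤-reflexive (sym (trans (·-neg (coverCoeff α) x) (cong -_ (coverCoeff-· x α)))))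
                                        (solves (covered∈ Aα)))

  -- The multipliers of the covering rows, restricted to the support of A and divided by the multiplier
  -- of the weight row, form a polyplex in A of weight greater than w.
  module FromCertificate (cert : FarkasCertificate constraints constraint) where
    open FarkasCertificate cert renaming (multiplier to μ; multiplier-nonNeg to 0≤μ)

    z : ℚ
    z = μ weightBound

    Q : QMatrix d n
    Q = mask A? (μ ∘ covered)

    ∑-constraints : ∀ (v : CoverConstraint d n → ℚ) → ∑ constraints (λ r → μ r * v r)
      ≡ ∑ support (λ α → μ (covered α) * v (covered α))
        + (∑ (allFin (d ℕ.* n)) (λ s → μ (nonNeg s) * v (nonNeg s)) + (z * v weightBound + 0ℚ))
    ∑-constraints v = trans (∑-++ (map covered support) _ μv) (cong₂ _+_ (∑-map covered support μv)
      (trans (∑-++ (map nonNeg (allFin (d ℕ.* n))) _ μv) (cong (_+ (z * v weightBound + 0ℚ)) (∑-map nonNeg (allFin (d ℕ.* n)) μv))))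
      where
      μv = λ r → μ r * v r

    hyperSum-Q : ∀ i j → hyperSum Q i j ≡ ∑ support (λ α → μ (covered α) * coverCoeff α (combine i j))
    hyperSum-Q i j = begin
      hyperSum Q i j
        ≡⟨ hyperSum-kronecker Q i j ⟩
      ∑ (allIdx d n) (λ α → kronecker (lookup α i) j * Q α)
        ≡⟨ ∑-cong (allIdx d n) (λ α → *-comm (kronecker (lookup α i) j) (Q α)) ⟩
      ∑ (allIdx d n) (λ α → Q α * kronecker (lookup α i) j)
        ≡⟨ ∑-mask-* A? (allIdx d n) (μ ∘ covered) (λ α → kronecker (lookup α i) j) ⟩
      ∑ support (λ α → μ (covered α) * kronecker (lookup α i) j)
        ≡⟨ ∑-cong support (λ α → cong (μ (covered α) *_) (sym (coverCoeff-combine α i j))) ⟩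
      ∑ support (λ α → μ (covered α) * coverCoeff α (combine i j)) ∎
      where open ≡-Reasoning

    coefficient-balance : ∀ t → ∑ support (λ α → μ (covered α) * coverCoeff α t) + μ (nonNeg t) ≡ z
    coefficient-balance t = begin
      a + u                                        ≡⟨ sym (+-identityʳ (a + u)) ⟩
      a + u + 0ℚ                                   ≡⟨ cong (a + u +_) (sym balance) ⟩
      a + u + (- a + (- u + (z * 1ℚ + 0ℚ)))
        ≡⟨ solve 3 (λ a u z → a :+ u :+ (:- a :+ (:- u :+ (z :* con 1ℚ :+ con 0ℚ))) := z) refl a u z ⟩
      z                                            ∎
      where
      open ≡-Reasoning
      a = ∑ support (λ α → μ (covered α) * coverCoeff α t)
      u = μ (nonNeg t)
      nonNeg-rows : ∑ (allFin (d ℕ.* n)) (λ s → μ (nonNeg s) * - kronecker s t) ≡ - u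
      nonNeg-rows = trans (∑-*-neg (allFin (d ℕ.* n)) (μ ∘ nonNeg) (λ s → kronecker s t)) (cong -_ (begin
        ∑ (allFin (d ℕ.* n)) (λ s → μ (nonNeg s) * kronecker s t)
          ≡⟨ ∑-cong (allFin (d ℕ.* n)) (λ s → trans (*-comm (μ (nonNeg s)) (kronecker s t)) (cong (_* μ (nonNeg s)) (kronecker-sym s t))) ⟩
        ∑ (allFin (d ℕ.* n)) (λ s → kronecker t s * μ (nonNeg s))   ≡⟨ ∑-kronecker (d ℕ.* n) t (μ ∘ nonNeg) ⟩
        u                                                           ∎))
      balance : - a + (- u + (z * 1ℚ + 0ℚ)) ≡ 0ℚ
      balance = trans (sym (cong₂ (λ p q → p + (q + (z * 1ℚ + 0ℚ))) (∑-*-neg support (μ ∘ covered) (λ α → coverCoeff α t)) nonNeg-rows))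
                      (trans (sym (∑-constraints (λ r → coeff (constraint r) t))) (combination-coeff t))

    hyperSum-Q≤z : ∀ i j → hyperSum Q i j ≤ z
    hyperSum-Q≤z i j = begin
      hyperSum Q i j   ≡⟨ trans (hyperSum-Q i j) (sym (+-identityʳ a)) ⟩
      a + 0ℚ           ≤⟨ +-monoʳ-≤ a (0≤μ (nonNeg (combine i j))) ⟩
      a + μ (nonNeg (combine i j))   ≡⟨ coefficient-balance (combine i j) ⟩
      z                ∎
      where
      open ≤-Reasoning
      a = ∑ support (λ α → μ (covered α) * coverCoeff α (combine i j))

    z*w<total-Q : z * w < total Q
    z*w<total-Q = begin-strict
      z * w                              ≡⟨ solve 2 (λ zw s → zw := :- s :+ (con 0ℚ :+ (zw :+ con 0ℚ)) :+ s) refl (z * w) S ⟩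
      - S + (0ℚ + (z * w + 0ℚ)) + S      <⟨ +-monoˡ-< S bound<0 ⟩
      0ℚ + S                             ≡⟨ +-identityˡ S ⟩
      S                                  ≡⟨ ∑-filter A? (allIdx d n) (μ ∘ covered) ⟩
      total Q                            ∎
      where
      open ≤-Reasoning
      S = ∑ support (μ ∘ covered)
      covered-rows : ∑ support (λ α → μ (covered α) * - 1ℚ) ≡ - S
      covered-rows = trans (∑-*-neg support (μ ∘ covered) (λ _ → 1ℚ)) (cong -_ (∑-cong support (λ α → *-identityʳ (μ (covered α)))))
      nonNeg-rows : ∑ (allFin (d ℕ.* n)) (λ s → μ (nonNeg s) * 0ℚ) ≡ 0ℚ
      nonNeg-rows = trans (∑-cong (allFin (d ℕ.* n)) (λ s → *-zeroʳ (μ (nonNeg s)))) (∑-zero (allFin (d ℕ.* n)))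
      bound<0 : - S + (0ℚ + (z * w + 0ℚ)) < 0ℚ
      bound<0 = ≤-<-trans (≤-reflexive (sym (trans (∑-constraints (bound ∘ constraint))
                  (cong₂ (λ p q → p + (q + (z * w + 0ℚ))) covered-rows nonNeg-rows)))) combination-bound

    0<z : Fin d → 0ℚ < z
    0<z i₀ = by-cases (0ℚ <? z)
      where
      by-cases : Dec (0ℚ < z) → 0ℚ < z
      by-cases (yes 0<z) = 0<z
      by-cases (no  0≮z) = ⊥-elim (<-irrefl refl (<-≤-trans 0<total-Q total-Q≤0))
        where
        open ≤-Reasoning
        z≡0 : z ≡ 0ℚ
        z≡0 = ≤-antisym (≮⇒≥ 0≮z) (0≤μ weightBound)
        0<total-Q : 0ℚ < total Q
        0<total-Q = begin-strict
          0ℚ       ≡⟨ sym (trans (cong (_* w) z≡0) (*-zeroˡ w)) ⟩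
          z * w    <⟨ z*w<total-Q ⟩
          total Q  ∎
        total-Q≤0 : total Q ≤ 0ℚ
        total-Q≤0 = begin
          total Q                             ≡⟨ total≡∑hyperSum Q i₀ ⟩
          ∑ (allFin n) (hyperSum Q i₀)        ≤⟨ ∑-mono-≤ (allFin n) (λ j → ≤-trans (hyperSum-Q≤z i₀ j) (≤-reflexive z≡0)) ⟩
          ∑ (allFin n) (λ _ → 0ℚ)             ≡⟨ ∑-zero (allFin n) ⟩
          0ℚ                                  ∎

    heavyPolyplex : Fin d → ∃ λ (K : QMatrix d n) → IsPolyplex K (total K) × Contains A K × w < total K
    heavyPolyplex i₀ = K , (0≤K , hyperSum-K≤1 , refl) , A⊇K , w<total-K
      where
      open ≤-Reasoning
      r = recip z
      0<r : 0ℚ < r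
      0<r = recip-pos (0<z i₀)
      z≢0 : z ≢ 0ℚ
      z≢0 = ≢-sym (<⇒≢ (0<z i₀))
      K : QMatrix d n
      K α = Q α * r
      0≤K : ∀ α → 0ℚ ≤ K α
      0≤K α = 0≤p*q (mask-nonNeg A? (0≤μ ∘ covered) α) (<⇒≤ 0<r)
      hyperSum-K≤1 : ∀ i j → hyperSum K i j ≤ 1ℚ
      hyperSum-K≤1 i j = begin
        hyperSum K i j      ≡⟨ sym (*-distribʳ-∑ r (filter (λ α → lookup α i ≟ᶠ j) (allIdx d n)) Q) ⟩
        hyperSum Q i j * r  ≤⟨ *-monoʳ-≤ (<⇒≤ 0<r) (hyperSum-Q≤z i j) ⟩
        z * r               ≡⟨ *-recip z z≢0 ⟩
        1ℚ                  ∎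
      A⊇K : Contains A K
      A⊇K α Kα≢0 = mask-support A? {μ ∘ covered} (λ Qα≡0 → Kα≢0 (trans (cong (_* r) Qα≡0) (*-zeroˡ r)))
      w<total-K : w < total K
      w<total-K = begin-strict
        w              ≡⟨ sym (*-r*recip w z≢0) ⟩
        z * (w * r)    ≡⟨ sym (*-assoc z w r) ⟩
        z * w * r      <⟨ *-monoˡ-<-pos r {{positive 0<r}} z*w<total-Q ⟩
        total Q * r    ≡⟨ *-distribʳ-∑ r (allIdx d n) Q ⟩
        total K        ∎

cheapCover⊎heavyPolyplex : ∀ {d n} → Fin d → (A : Matrix01 d n) (w : ℚ) →
  (∃ λ Λ → IsHyperplaneCover A Λ × weight Λ ≤ w) ⊎ (∃ λ K → IsPolyplex K (total K) × Contains A K × w < total K)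
cheapCover⊎heavyPolyplex {d} {n} i₀ A w =
  Sum.map (λ (x , solves) → toTable x , solution⇒cover solves) (λ cert → FromCertificate.heavyPolyplex cert i₀)
          (farkas (d ℕ.* n) constraints constraint)
  where open CoverLP A w

-- Optimal covers of extremal matrices

module _ {d n : ℕ} {A : Matrix01 d n} where

  deficiency-pos : ∀ {δ} → Fin d → ¬ ContainsPolydiagonal A → IsDeficiency A δ → 0ℚ < δ
  deficiency-pos {δ} i₀ noPolydiagonal ((K , (0≤K , hyperSum≤1 , total≡n-δ) , A⊇K) , _) = by-cases (0ℚ <? δ)
    where
    by-cases : Dec (0ℚ < δ) → 0ℚ < δ
    by-cases (yes 0<δ) = 0<δ
    by-cases (no  0≮δ) = ⊥-elim (noPolydiagonal (K , (0≤K , hyperSum≤1 , ≤-antisym (total≤n i₀ hyperSum≤1) n≤total) , A⊇K))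
      where
      n≤total : ℕtoℚ n ≤ total K
      n≤total = begin
        ℕtoℚ n          ≡⟨ sym (+-identityʳ (ℕtoℚ n)) ⟩
        ℕtoℚ n + 0ℚ     ≤⟨ +-monoʳ-≤ (ℕtoℚ n) (neg-antimono-≤ (≮⇒≥ 0≮δ)) ⟩
        ℕtoℚ n - δ      ≡⟨ sym total≡n-δ ⟩
        total K         ∎
        where open ≤-Reasoning

  optimalCover-weight≤ : ∀ {δ Λ} → Fin d → IsDeficiency A δ → IsOptimalCover A Λ → weight Λ ≤ ℕtoℚ n - δ
  optimalCover-weight≤ {δ} {Λ} i₀ (_ , maximal) (_ , minimal) = Sum.[ cheapCover , heavyPolyplex ] (cheapCover⊎heavyPolyplex i₀ A (ℕtoℚ n - δ))
    where
    cheapCover : (∃ λ Λ′ → IsHyperplaneCover A Λ′ × weight Λ′ ≤ ℕtoℚ n - δ) → weight Λ ≤ ℕtoℚ n - δ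
    cheapCover (Λ′ , cover , weight≤) = ≤-trans (minimal Λ′ cover) weight≤
    heavyPolyplex : (∃ λ K → IsPolyplex K (total K) × Contains A K × ℕtoℚ n - δ < total K) → weight Λ ≤ ℕtoℚ n - δ
    heavyPolyplex (K , polyplex , A⊇K , n-δ<total) = ⊥-elim (<-irrefl refl (<-≤-trans n-δ<total (maximal K (total K) polyplex A⊇K)))

  -- Complementary slackness with K: Λ vanishes on every hyperplane that K does not fill.
  cover-rowHasZero : ∀ {K : QMatrix d n} {W Λ} → IsPolyplex K W → Contains A K → W < ℕtoℚ n →
    IsHyperplaneCover A Λ → weight Λ ≤ W → ∀ k → ∃ λ j → Λ k j ≡ 0ℚ
  cover-rowHasZero {K} {W} {Λ} (0≤K , hyperSum≤1 , total≡W) A⊇K W<n cover@(0≤Λ , _) weight≤W k =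
    j , ≤-antisym (*-cancelʳ-≤-pos (gap k j) {{positive 0<gap}} Λkj*gap≤0) (0≤Λ k j)
    where
    open ≤-Reasoning
    gap : Fin d → Fin n → ℚ
    gap i j = 1ℚ - hyperSum K i j
    Λ*gap : Fin d → Fin n → ℚ
    Λ*gap i j = Λ i j * gap i j
    0≤Λ*gap : ∀ i j → 0ℚ ≤ Λ*gap i j
    0≤Λ*gap i j = 0≤p*q (0≤Λ i j) (p≤q⇒0≤q-p (hyperSum≤1 i j))
    ∑Λ*gap≤0 : ∑ (allFin d) (λ i → ∑ (allFin n) (Λ*gap i)) ≤ 0ℚ
    ∑Λ*gap≤0 = begin
      ∑ (allFin d) (λ i → ∑ (allFin n) (Λ*gap i))            ≡⟨ sym (weight-∑-*-coverSum K Λ) ⟩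
      weight Λ - ∑ (allIdx d n) (λ α → K α * coverSum Λ α)
        ≤⟨ +-monoʳ-≤ (weight Λ) (neg-antimono-≤ (total≤∑-*-coverSum 0≤K A⊇K cover)) ⟩
      weight Λ - total K                                    ≤⟨ +-monoˡ-≤ (- total K) weight≤W ⟩
      W - total K                                           ≡⟨ cong (λ t → W - t) total≡W ⟩
      W - W                                                 ≡⟨ +-inverseʳ W ⟩
      0ℚ                                                    ∎
    ∑gap : ∑ (allFin n) (gap k) ≡ ℕtoℚ n - W
    ∑gap = begin-equality
      ∑ (allFin n) (gap k)                                   ≡⟨ ∑-distrib-sub (allFin n) (λ _ → 1ℚ) (hyperSum K k) ⟩
      ∑ (allFin n) (λ _ → 1ℚ) - ∑ (allFin n) (hyperSum K k)  ≡⟨ cong₂ _-_ (∑-allFin-1 n) (trans (sym (total≡∑hyperSum K k)) total≡W) ⟩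
      ℕtoℚ n - W                                             ∎
    gap-pos : ∃ λ j → j ∈ allFin n × 0ℚ < gap k j
    gap-pos = ∑-pos⇒∃-pos (allFin n) (<-≤-trans (p<q⇒0<q-p W<n) (≤-reflexive (sym ∑gap)))
    j = proj₁ gap-pos
    0<gap = proj₂ (proj₂ gap-pos)
    Λkj*gap≤0 : Λ k j * gap k j ≤ 0ℚ * gap k j
    Λkj*gap≤0 = begin
      Λ*gap k j                                    ≤⟨ term≤∑ (λ {j′} _ → 0≤Λ*gap k j′) (∈-allFin j) ⟩
      ∑ (allFin n) (Λ*gap k)                       ≤⟨ term≤∑ (λ {i} _ → ∑-nonNeg (allFin n) (λ {j′} _ → 0≤Λ*gap i j′)) (∈-allFin k) ⟩
      ∑ (allFin d) (λ i → ∑ (allFin n) (Λ*gap i))  ≤⟨ ∑Λ*gap≤0 ⟩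
      0ℚ                                           ≡⟨ sym (*-zeroˡ (gap k j)) ⟩
      0ℚ * gap k j                                 ∎

  setOne-≢ : ∀ {α β} → β ≢ α → setOne A α β ≡ A β
  setOne-≢ {α} {β} β≢α = cong (λ b → if b then true else A β) (dec-false (≡-dec _≟ᶠ_ β α) β≢α)

  setOne-total≤∑-*-coverSum : ∀ {K : QMatrix d n} {Λ α} → (∀ β → 0ℚ ≤ K β) → Contains (setOne A α) K → IsHyperplaneCover A Λ →
    total K - ∑ (filter (λ β → ≡-dec _≟ᶠ_ β α) (allIdx d n)) K * (1ℚ - coverSum Λ α) ≤ ∑ (allIdx d n) (λ β → K β * coverSum Λ β)
  setOne-total≤∑-*-coverSum {K} {Λ} {α} 0≤K A+α⊇K cover = begin
    total K - ∑ (filter ≟α (allIdx d n)) K * (1ℚ - c)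
      ≡⟨ cong (λ t → total K - t)
           (trans (cong (_* (1ℚ - c)) (∑-filter ≟α (allIdx d n) K)) (*-distribʳ-∑ (1ℚ - c) (allIdx d n) (mask ≟α K))) ⟩
    total K - ∑ (allIdx d n) (λ β → mask ≟α K β * (1ℚ - c))
      ≡⟨ sym (∑-distrib-sub (allIdx d n) K (λ β → mask ≟α K β * (1ℚ - c))) ⟩
    ∑ (allIdx d n) (λ β → K β - mask ≟α K β * (1ℚ - c))
      ≤⟨ ∑-mono-≤ (allIdx d n) (λ β → by-cases β (≟α β)) ⟩
    ∑ (allIdx d n) (λ β → K β * coverSum Λ β) ∎
    where
    open ≤-Reasoning
    c = coverSum Λ α
    ≟α = λ β → ≡-dec _≟ᶠ_ β α
    by-cases : ∀ β → Dec (β ≡ α) → K β - mask ≟α K β * (1ℚ - c) ≤ K β * coverSum Λ β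
    by-cases β (yes β≡α) = ≤-reflexive (begin-equality
      K β - mask ≟α K β * (1ℚ - c)    ≡⟨ cong (λ m → K β - m * (1ℚ - c)) (mask-yes ≟α {K} β≡α) ⟩
      K β - K β * (1ℚ - c)            ≡⟨ solve 2 (λ k c → k :- k :* (con 1ℚ :- c) := k :* c) refl (K β) c ⟩
      K β * c                         ≡⟨ cong (λ γ → K β * coverSum Λ γ) (sym β≡α) ⟩
      K β * coverSum Λ β              ∎)
    by-cases β (no β≢α) = begin
      K β - mask ≟α K β * (1ℚ - c)    ≡⟨ cong (λ m → K β - m * (1ℚ - c)) (mask-no ≟α {K} β≢α) ⟩
      K β - 0ℚ * (1ℚ - c)             ≡⟨ solve 2 (λ k c → k :- con 0ℚ :* (con 1ℚ :- c) := k) refl (K β) c ⟩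
      K β                             ≤⟨ K≤K*coverSum {K = K} (0≤K β) (λ Kβ≢0 → trans (sym (setOne-≢ β≢α)) (A+α⊇K β Kβ≢0)) cover ⟩
      K β * coverSum Λ β              ∎

  zeroEntry-coverSum≤ : ∀ {δ Λ α} → Fin d → 0ℚ < δ → IsHyperplaneCover A Λ → weight Λ ≤ ℕtoℚ n - δ →
    ContainsPolydiagonal (setOne A α) → coverSum Λ α ≤ 1ℚ - δ
  zeroEntry-coverSum≤ {δ} {Λ} {α} i₀ 0<δ cover@(0≤Λ , _) weight≤ (K , (0≤K , hyperSum≤1 , total≡n) , A+α⊇K) =
    0≤q-p⇒p≤q (≤-trans (p≤q⇒0≤q-p (≤-fraction-*⇒≤ 0<δ 0≤s s≤1 δ≤s*[1-c]))
                       (≤-reflexive (solve 2 (λ c δ → con 1ℚ :- c :- δ := con 1ℚ :- δ :- c) refl c δ)))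
    where
    open ≤-Reasoning
    c = coverSum Λ α
    ≟α = λ β → ≡-dec _≟ᶠ_ β α
    s = ∑ (filter ≟α (allIdx d n)) K
    0≤s : 0ℚ ≤ s
    0≤s = ∑-nonNeg (filter ≟α (allIdx d n)) (λ {β} _ → 0≤K β)
    s≤1 : s ≤ 1ℚ
    s≤1 = ≤-trans (∑-filter-⊆ ≟α (λ β → lookup β i₀ ≟ᶠ lookup α i₀) (allIdx d n) (cong (λ β → lookup β i₀)) 0≤K)
                  (hyperSum≤1 i₀ (lookup α i₀))
    n-s*[1-c]≤n-δ : ℕtoℚ n - s * (1ℚ - c) ≤ ℕtoℚ n - δ
    n-s*[1-c]≤n-δ = begin
      ℕtoℚ n - s * (1ℚ - c)                       ≡⟨ cong (λ t → t - s * (1ℚ - c)) (sym total≡n) ⟩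
      total K - s * (1ℚ - c)                      ≤⟨ setOne-total≤∑-*-coverSum 0≤K A+α⊇K cover ⟩
      ∑ (allIdx d n) (λ β → K β * coverSum Λ β)   ≤⟨ ∑-*-coverSum≤weight 0≤Λ hyperSum≤1 ⟩
      weight Λ                                    ≤⟨ weight≤ ⟩
      ℕtoℚ n - δ                                  ∎
    δ≤s*[1-c] : δ ≤ s * (1ℚ - c)
    δ≤s*[1-c] = 0≤q-p⇒p≤q (≤-trans (p≤q⇒0≤q-p n-s*[1-c]≤n-δ)
      (≤-reflexive (solve 3 (λ n δ x → n :- δ :- (n :- x) := x :- δ) refl (ℕtoℚ n) δ (s * (1ℚ - c)))))

  optimalCover-entry≤1 : ∀ {Λ} → IsOptimalCover A Λ → ∀ i j → Λ i j ≤ 1ℚ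
  optimalCover-entry≤1 {Λ} optimal@((0≤Λ , _) , _) i j = 0≤q-p⇒p≤q (optimal-adjust optimal 0≤Λij+[1-Λij] covers)
    where
    open ≤-Reasoning
    0≤Λij+[1-Λij] : 0ℚ ≤ Λ i j + (1ℚ - Λ i j)
    0≤Λij+[1-Λij] = ≤-trans (nonNegative⁻¹ 1ℚ) (≤-reflexive (solve 1 (λ l → con 1ℚ := l :+ (con 1ℚ :- l)) refl (Λ i j)))
    covers : ∀ α → A α ≡ true → lookup α i ≡ j → 1ℚ ≤ coverSum Λ α + (1ℚ - Λ i j)
    covers α _ αi≡j = begin
      1ℚ                            ≡⟨ solve 1 (λ l → con 1ℚ := l :+ (con 1ℚ :- l)) refl (Λ i j) ⟩
      Λ i j + (1ℚ - Λ i j)          ≡⟨ cong (λ j′ → Λ i j′ + (1ℚ - Λ i j)) (sym αi≡j) ⟩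
      Λ i (lookup α i) + (1ℚ - Λ i j) ≤⟨ +-monoˡ-≤ (1ℚ - Λ i j) (entry≤coverSum 0≤Λ α i) ⟩
      coverSum Λ α + (1ℚ - Λ i j)   ∎

  optimalCover-δ≤entry : ∀ {δ Λ} → IsOptimalCover A Λ → (∀ k → ∃ λ j → Λ k j ≡ 0ℚ) →
    (∀ α → A α ≡ false → coverSum Λ α ≤ 1ℚ - δ) → ∀ i j → 0ℚ < Λ i j → δ ≤ Λ i j
  optimalCover-δ≤entry {δ} {Λ} optimal@((0≤Λ , covers) , _) rowZero zeroEntry≤ i j 0<Λij =
    by-cases (∃?-Index (λ α → (A α ≟ᵇ false) ×-dec (A (α [ i ]≔ j) ≟ᵇ true)))
    where
    open ≤-Reasoning
    by-cases : Dec (∃ λ α → A α ≡ false × A (α [ i ]≔ j) ≡ true) → δ ≤ Λ i j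
    by-cases (yes (α , Aα≡false , Aα′≡true)) = 0≤q-p⇒p≤q (begin
      0ℚ
        ≤⟨ 0≤p+q (0≤p+q (p≤q⇒0≤q-p (covers _ Aα′≡true)) (p≤q⇒0≤q-p (zeroEntry≤ α Aα≡false))) (0≤Λ i (lookup α i)) ⟩
      coverSum Λ (α [ i ]≔ j) - 1ℚ + (1ℚ - δ - coverSum Λ α) + Λ i (lookup α i)
        ≡⟨ cong (λ c′ → c′ - 1ℚ + (1ℚ - δ - coverSum Λ α) + Λ i (lookup α i)) (coverSum-[]≔ Λ α i j) ⟩
      coverSum Λ α + (Λ i j - Λ i (lookup α i)) - 1ℚ + (1ℚ - δ - coverSum Λ α) + Λ i (lookup α i)
        ≡⟨ solve 4 (λ c l l′ δ → c :+ (l :- l′) :- con 1ℚ :+ (con 1ℚ :- δ :- c) :+ l′ := l :- δ) refl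
                   (coverSum Λ α) (Λ i j) (Λ i (lookup α i)) δ ⟩
      Λ i j - δ ∎)
    -- Every index of A in Γ_{i,j} stays in A when moved to the zero column j₀ of row i, so Λ i j can be lowered to 0.
    by-cases (no none) = ⊥-elim (<-irrefl refl (<-≤-trans (neg-antimono-< 0<Λij) (optimal-adjust optimal 0≤Λij-Λij covers-Γij)))
      where
      j₀ = proj₁ (rowZero i)
      0≤Λij-Λij : 0ℚ ≤ Λ i j + - Λ i j
      0≤Λij-Λij = ≤-reflexive (sym (+-inverseʳ (Λ i j)))
      covers-Γij : ∀ α → A α ≡ true → lookup α i ≡ j → 1ℚ ≤ coverSum Λ α + - Λ i j
      covers-Γij α Aα αi≡j = begin
        1ℚ                                              ≤⟨ covers (α [ i ]≔ j₀) Aα′ ⟩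
        coverSum Λ (α [ i ]≔ j₀)                        ≡⟨ coverSum-[]≔ Λ α i j₀ ⟩
        coverSum Λ α + (Λ i j₀ - Λ i (lookup α i))      ≡⟨ cong₂ (λ a b → coverSum Λ α + (a - Λ i b)) (proj₂ (rowZero i)) αi≡j ⟩
        coverSum Λ α + (0ℚ - Λ i j)                     ≡⟨ cong (coverSum Λ α +_) (+-identityˡ (- Λ i j)) ⟩
        coverSum Λ α + - Λ i j                          ∎
        where
        back : (α [ i ]≔ j₀) [ i ]≔ j ≡ α
        back = trans ([]≔-idempotent α i) (trans (cong (α [ i ]≔_) (sym αi≡j)) ([]≔-lookup α i))
        Aα′ : A (α [ i ]≔ j₀) ≡ true
        Aα′ = decidable-stable (A (α [ i ]≔ j₀) ≟ᵇ true) λ Aα′≢true →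
          none (α [ i ]≔ j₀ , ¬-not Aα′≢true , trans (cong A back) Aα)

  optimalCover-entry≤1-δ : ∀ {δ Λ} → IsOptimalCover A Λ → (∀ k → ∃ λ j → Λ k j ≡ 0ℚ) →
    (∀ α → A α ≡ false → coverSum Λ α ≤ 1ℚ - δ) → ∀ i j → Λ i j ≢ 1ℚ → Λ i j ≤ 1ℚ - δ
  optimalCover-entry≤1-δ {δ} {Λ} optimal@((0≤Λ , covers) , _) rowZero zeroEntry≤ i j Λij≢1 =
    by-cases (∃?-Index (λ α → (lookup α i ≟ᶠ j) ×-dec (A α ≟ᵇ false)))
    where
    open ≤-Reasoning
    by-cases : Dec (∃ λ α → lookup α i ≡ j × A α ≡ false) → Λ i j ≤ 1ℚ - δ
    by-cases (yes (α , αi≡j , Aα≡false)) = begin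
      Λ i j              ≡⟨ cong (Λ i) (sym αi≡j) ⟩
      Λ i (lookup α i)   ≤⟨ entry≤coverSum 0≤Λ α i ⟩
      coverSum Λ α       ≤⟨ zeroEntry≤ α Aα≡false ⟩
      1ℚ - δ             ∎
    -- Γ_{i,j} lies in A, and its index α* meeting a zero of Λ in every other direction is covered by Λ i j alone.
    by-cases (no none) = ⊥-elim (Λij≢1 (≤-antisym (optimalCover-entry≤1 optimal i j) 1≤Λij))
      where
      zeros : Index d n
      zeros = tabulate (proj₁ ∘ rowZero)
      α* : Index d n
      α* = zeros [ i ]≔ j
      Aα* : A α* ≡ true
      Aα* = decidable-stable (A α* ≟ᵇ true) λ Aα*≢true → none (α* , lookup∘update i zeros j , ¬-not Aα*≢true)
      coverSum-zeros : coverSum Λ zeros ≡ 0ℚ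
      coverSum-zeros = trans (∑-cong (allFin d) (λ k → trans (cong (Λ k) (lookup∘tabulate (proj₁ ∘ rowZero) k)) (proj₂ (rowZero k))))
                             (∑-zero (allFin d))
      1≤Λij : 1ℚ ≤ Λ i j
      1≤Λij = begin
        1ℚ                                               ≤⟨ covers α* Aα* ⟩
        coverSum Λ α*                                    ≡⟨ coverSum-[]≔ Λ zeros i j ⟩
        coverSum Λ zeros + (Λ i j - Λ i (lookup zeros i)) ≡⟨ cong₂ (λ a b → a + (Λ i j - b)) coverSum-zeros
                                                              (trans (cong (Λ i) (lookup∘tabulate (proj₁ ∘ rowZero) i)) (proj₂ (rowZero i))) ⟩
        0ℚ + (Λ i j - 0ℚ)                                ≡⟨ solve 1 (λ l → con 0ℚ :+ (l :- con 0ℚ) := l) refl (Λ i j) ⟩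
        Λ i j                                            ∎

proposition5p6 : (d n : ℕ) (A : Matrix01 d n) (δ : ℚ) (Λ : Table d n) →
    IsExtremal A → IsDeficiency A δ → IsOptimalCover A Λ →
    ∀ (i : Fin d) (j : Fin n) → Λ i j ≢ 0ℚ → Λ i j ≢ 1ℚ →
    (δ ≤ Λ i j) × (Λ i j ≤ 1ℚ - δ)
proposition5p6 d n A δ Λ (noPolydiagonal , saturated) deficiency optimal@(cover , _) i j Λij≢0 Λij≢1 =
  optimalCover-δ≤entry {δ = δ} optimal rowZero zeroEntry≤ i j (≤∧≢⇒< (proj₁ cover i j) (Λij≢0 ∘ sym)) ,
  optimalCover-entry≤1-δ {δ = δ} optimal rowZero zeroEntry≤ i j Λij≢1
  where
  0<δ : 0ℚ < δ
  0<δ = deficiency-pos i noPolydiagonal deficiency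
  light : weight Λ ≤ ℕtoℚ n - δ
  light = optimalCover-weight≤ i deficiency optimal
  zeroEntry≤ : ∀ α → A α ≡ false → coverSum Λ α ≤ 1ℚ - δ
  zeroEntry≤ α Aα≡false = zeroEntry-coverSum≤ i 0<δ cover light (saturated α Aα≡false)
  rowZero : ∀ k → ∃ λ j → Λ k j ≡ 0ℚ
  rowZero = let (K , polyplex , A⊇K) = proj₁ deficiency in
    cover-rowHasZero polyplex A⊇K (p-q<p 0<δ) cover light
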